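{- (2-cut with spill) In the multirole logic MRL over a set of roles $\mathcal{R}$, let $R_1,R_2\subseteq\mathcal{R}$ be such that $\mathcal{R}\setminus R_1$ and $\mathcal{R}\setminus R_2$ are disjoint. Then for all sequents $\Gamma_1,\Gamma_2$ and every formula $A$: if $\vdash\Gamma_1,[R_1]A$ and $\vdash\Gamma_2,[R_2]A$ are derivable, then $\vdash\Gamma_1,\Gamma_2,[R_1\cap R_2]A$ is derivable.
   Context: Fix a set $\mathcal{R}$ (the set of roles), possibly infinite. For $R\subseteq\mathcal{R}$ write $\overline{R}=\mathcal{R}\setminus R$. Writing $R_1\uplus\cdots\uplus R_n$ means the union of the pairwise disjoint sets $R_1,\dots,R_n$ (the notation asserts disjointness). A filter on $\mathcal{R}$ is a set $\mathcal{F}$ of subsets of $\mathcal{R}$ with $\mathcal{R}\in\mathcal{F}$, such that $R_1\in\mathcal{F}$ and $R_1\subseteq R_2$ imply $R_2\in\mathcal{F}$, and $R_1,R_2\in\mathcal{F}$ imply $R_1\cap R_2\in\mathcal{F}$; an ultrafilter $\mathcal{U}$ is a filter such that for every $R\subseteq\mathcal{R}$, $R\in\mathcal{U}$ or $\overline{R}\in\mathcal{U}$. An endomorphism is any function $f:\mathcal{R}\to\mathcal{R}$, and $f^{ -1}(R)$ is the preimage. First-order terms $t$ and atomic formulas $a$ are standard. Formulas of MRL: $A ::= a \mid \neg_f(A) \mid A_1\wedge_{\mathcal{U}}A_2 \mid A\supset_{f,\mathcal{U}}B \mid \forall_{\mathcal{U}}(\lambda x.A)$, with $f$ an endomorphism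 and $\mathcal{U}$ an ultrafilter on $\mathcal{R}$; $A[x:=t]$ is substitution. An i-formula is $[R]A$ with $R\subseteq\mathcal{R}$ and $A$ a formula. A sequent $\Gamma$ is a finite multiset of i-formulas; commas denote multiset union. Derivable sequents $\vdash\Gamma$ are generated by the rules: (Id) $\vdash\Gamma,[R_1]a,\dots,[R_n]a$ for any $\Gamma$, atomic $a$, $n\ge1$ and $R_1\uplus\cdots\uplus R_n=\mathcal{R}$; (contraction) from $\vdash\Gamma,[R]A,[R]A$ infer $\vdash\Gamma,[R]A$; ($\neg$) from $\vdash\Gamma,[f^{ -1}(R)]A$ infer $\vdash\Gamma,[R]\neg_f(A)$; ($\wedge$-neg) if $R\notin\mathcal{U}$, from $\vdash\Gamma,[R]A$ or from $\vdash\Gamma,[R]B$ infer $\vdash\Gamma,[R](A\wedge_{\mathcal{U}}B)$; ($\wedge$-pos) if $R\in\mathcal{U}$, from $\vdash\Gamma,[R]A$ and $\vdash\Gamma,[R]B$ infer $\vdash\Gamma,[R](A\wedge_{\mathcal{U}}B)$; ($\supset$-neg) if $R\notin\mathcal{U}$, from $\vdash\Gamma,[f^{ -1}(R)]A,[R]B$ infer $\vdash\Gamma,[R](A\supset_{f,\mathcal{U}}B)$; ($\supset$-pos) if $R\in\mathcal{U}$, from $\vdash\Gamma_1,[f^{ -1}(R)]A$ and $\vdash\Gamma_2,[R]B$ infer $\vdash\Gamma_1,\Gamma_2,[R](A\supset_{f,\mathcal{U}}B)$; ($\forall$-neg) if $R\notin\mathcal{U}$, from $\vdash\Gamma,[R]A[x:=t]$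 for some term $t$ infer $\vdash\Gamma,[R]\forall_{\mathcal{U}}(\lambda x.A)$; ($\forall$-pos) if $R\in\mathcal{U}$ and $x$ has no free occurrence in $\Gamma$, from $\vdash\Gamma,[R]A$ infer $\vdash\Gamma,[R]\forall_{\mathcal{U}}(\lambda x.A)$. -}

module Defs where

open import Data.Bool using (Bool; true; false; _∧_; not)
open import Data.Nat using (ℕ; zero; suc; _+_; _≤_)
open import Data.List using (List; []; _∷_; _++_; map; length)
open import Data.Sum using (_⊎_)
open import Data.Product using (_×_)
open import Relation.Nullary using (¬_)
open import Relation.Binary.PropositionalEquality using (_≡_)
open import Data.List.Relation.Binary.Permutation.Homogeneous using (Permutation)

-- First-order terms (de Bruijn variables, function symbols named by ℕ)

data Term : Set where
  var : ℕ → Term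
  fn  : ℕ → List Term → Term

mutual
  renT : (ℕ → ℕ) → Term → Term
  renT ρ (var x)   = var (ρ x)
  renT ρ (fn g ts) = fn g (renTs ρ ts)

  renTs : (ℕ → ℕ) → List Term → List Term
  renTs ρ []       = []
  renTs ρ (t ∷ ts) = renT ρ t ∷ renTs ρ ts

mutual
  subT : (ℕ → Term) → Term → Term
  subT σ (var x)   = σ x
  subT σ (fn g ts) = fn g (subTs σ ts)

  subTs : (ℕ → Term) → List Term → List Term
  subTs σ []       = []
  subTs σ (t ∷ ts) = subT σ t ∷ subTs σ ts

liftRen : (ℕ → ℕ) → ℕ → ℕ
liftRen ρ zero    = zero
liftRen ρ (suc n) = suc (ρ n)

liftSub : (ℕ → Term) → ℕ → Term
liftSub σ zero    = var zero
liftSub σ (suc n) = renT suc (σ n)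

single : Term → ℕ → Term
single t zero    = t
single t (suc n) = var n

module MRL (ℛ : Set) where

  Subset : Set
  Subset = ℛ → Bool

  ∁ : Subset → Subset
  ∁ R r = not (R r)

  _∩_ : Subset → Subset → Subset
  (R₁ ∩ R₂) r = R₁ r ∧ R₂ r

  _⊆_ : Subset → Subset → Set
  R₁ ⊆ R₂ = ∀ r → R₁ r ≡ true → R₂ r ≡ true

  _≐_ : Subset → Subset → Set
  R₁ ≐ R₂ = ∀ r → R₁ r ≡ R₂ r

  full : Subset
  full _ = true

  pre : (ℛ → ℛ) → Subset → Subset
  pre f R r = R (f r)

  record Ultrafilter : Set₁ where
    field
      _∈U       : Subset → Set
      full∈     : full ∈U
      up-closed : ∀ {R₁ R₂} → R₁ ∈U → R₁ ⊆ R₂ → R₂ ∈U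
      ∩-closed  : ∀ {R₁ R₂} → R₁ ∈U → R₂ ∈U → (R₁ ∩ R₂) ∈U
      ultra     : ∀ R → R ∈U ⊎ (∁ R) ∈U

  open Ultrafilter public

  _∈_ : Subset → Ultrafilter → Set
  R ∈ 𝒰 = _∈U 𝒰 R

  _∉_ : Subset → Ultrafilter → Set
  R ∉ 𝒰 = ¬ (R ∈ 𝒰)

  -- Formulas; the body of ∀ binds de Bruijn variable 0
  data Formula : Set₁ where
    atom : ℕ → List Term → Formula
    neg  : (ℛ → ℛ) → Formula → Formula
    conj : Ultrafilter → Formula → Formula → Formula
    imp  : (ℛ → ℛ) → Ultrafilter → Formula → Formula → Formula
    all  : Ultrafilter → Formula → Formula

  renF : (ℕ → ℕ) → Formula → Formula
  renF ρ (atom p ts)    = atom p (renTs ρ ts)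
  renF ρ (neg f A)      = neg f (renF ρ A)
  renF ρ (conj 𝒰 A B)   = conj 𝒰 (renF ρ A) (renF ρ B)
  renF ρ (imp f 𝒰 A B)  = imp f 𝒰 (renF ρ A) (renF ρ B)
  renF ρ (all 𝒰 A)      = all 𝒰 (renF (liftRen ρ) A)

  subF : (ℕ → Term) → Formula → Formula
  subF σ (atom p ts)    = atom p (subTs σ ts)
  subF σ (neg f A)      = neg f (subF σ A)
  subF σ (conj 𝒰 A B)   = conj 𝒰 (subF σ A) (subF σ B)
  subF σ (imp f 𝒰 A B)  = imp f 𝒰 (subF σ A) (subF σ B)
  subF σ (all 𝒰 A)      = all 𝒰 (subF (liftSub σ) A)

  _[0:=_] : Formula → Term → Formula
  A [0:= t ] = subF (single t) A

  infix 6 [_]_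
  record IFormula : Set₁ where
    constructor [_]_
    field
      set  : Subset
      form : Formula

  _≈ᵢ_ : IFormula → IFormula → Set₁
  ([ R ] A) ≈ᵢ ([ R' ] A') = (R ≐ R') × (A ≡ A')

  -- sequents: finite multisets of i-formulas, represented by lists taken
  -- up to permutation (and extensional equality of role sets)
  Sequent : Set₁
  Sequent = List IFormula

  _≋_ : Sequent → Sequent → Set₁
  _≋_ = Permutation _≈ᵢ_

  _,,_ : Sequent → IFormula → Sequent
  Γ ,, i = Γ ++ (i ∷ [])

  infixl 4 _,,_

  -- weakening of the free variables of a sequent (x not free in Γ)
  shiftS : Sequent → Sequent
  shiftS = map (λ i → [ IFormula.set i ] renF suc (IFormula.form i))

  hits : ℛ → List Subset → ℕ
  hits r []       = 0
  hits r (R ∷ Rs) with R r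
  ... | true  = suc (hits r Rs)
  ... | false = hits r Rs

  -- R₁ ⊎ ⋯ ⊎ Rₙ = ℛ  (pairwise disjoint sets covering ℛ)
  Partition : List Subset → Set
  Partition Rs = ∀ r → hits r Rs ≡ 1

  data ⊢_ : Sequent → Set₁ where
    perm : ∀ {Γ Δ} → Γ ≋ Δ → ⊢ Γ → ⊢ Δ
    Id : ∀ Γ p ts (Rs : List Subset) → 1 ≤ length Rs → Partition Rs →
         ⊢ (Γ ++ map (λ R → [ R ] atom p ts) Rs)
    contraction : ∀ {Γ R A} → ⊢ (Γ ,, [ R ] A ,, [ R ] A) → ⊢ (Γ ,, [ R ] A)
    ¬-rule : ∀ {Γ R f A} → ⊢ (Γ ,, [ pre f R ] A) → ⊢ (Γ ,, [ R ] neg f A)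
    ∧-neg₁ : ∀ {Γ R 𝒰 A B} → R ∉ 𝒰 → ⊢ (Γ ,, [ R ] A) → ⊢ (Γ ,, [ R ] conj 𝒰 A B)
    ∧-neg₂ : ∀ {Γ R 𝒰 A B} → R ∉ 𝒰 → ⊢ (Γ ,, [ R ] B) → ⊢ (Γ ,, [ R ] conj 𝒰 A B)
    ∧-pos  : ∀ {Γ R 𝒰 A B} → R ∈ 𝒰 → ⊢ (Γ ,, [ R ] A) → ⊢ (Γ ,, [ R ] B) →
             ⊢ (Γ ,, [ R ] conj 𝒰 A B)
    ⊃-neg : ∀ {Γ R f 𝒰 A B} → R ∉ 𝒰 → ⊢ (Γ ,, [ pre f R ] A ,, [ R ] B) →
            ⊢ (Γ ,, [ R ] imp f 𝒰 A B)
    ⊃-pos : ∀ {Γ₁ Γ₂ R f 𝒰 A B} → R ∈ 𝒰 → ⊢ (Γ₁ ,, [ pre f R ] A) → ⊢ (Γ₂ ,, [ R ] B) →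
            ⊢ (Γ₁ ++ Γ₂ ,, [ R ] imp f 𝒰 A B)
    ∀-neg : ∀ {Γ R 𝒰 A} (t : Term) → R ∉ 𝒰 → ⊢ (Γ ,, [ R ] (A [0:= t ])) →
            ⊢ (Γ ,, [ R ] all 𝒰 A)
    ∀-pos : ∀ {Γ R 𝒰 A} → R ∈ 𝒰 → ⊢ (shiftS Γ ,, [ R ] A) →
            ⊢ (Γ ,, [ R ] all 𝒰 A)

-- The conclusion keeps the cut formula, as [ R₁ ∩ R₂ ] A, so a reduction step never has to
-- remove it: residual copies are left in place and contracted at the end. To absorb contraction
-- the cut is generalised to a mix removing any number of copies of [ R₁ ] A and [ R₂ ] A at once,
-- proved by induction on the size of A and then on the sum of the heights of the derivations.
-- If one side does not introduce a copy by its last rule, the mix is permuted above that rule.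
-- If both do, each premise is mixed with the whole derivation on the other side and the results
-- are cut on the immediate subformulas. The side conditions of the rules match because
-- R₁ ∩ R₂ ∈ 𝒰 iff R₁ ∈ 𝒰 and R₂ ∈ 𝒰, while R₁ and R₂ cannot both lie outside 𝒰 since their
-- complements are disjoint. For the same reason two identity axioms with role partitions
-- R₁ ⊎ Ss and R₂ ⊎ Ts merge into the axiom with partition (R₁ ∩ R₂) ⊎ Ss ⊎ Ts.

module Submission where

open import Defs
open import Data.Bool using (Bool; true; false; _∧_; not; if_then_else_)
open import Data.Bool.Properties using (∧-comm; ∧-conicalˡ; ∧-conicalʳ)
open import Data.Nat using (ℕ; zero; suc; _+_; _≤_; z≤n; s≤s; _⊔_)
open import Data.Nat.Properties
  using (+-suc; +-assoc; +-comm; +-identityʳ; m+n≡0⇒m≡0; suc-injective; ≤-refl; m≤m⊔n; m≤n⊔m;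
         m+n≤o⇒m≤o; m+n≤o⇒n≤o; +-commutativeSemigroup)
open import Algebra.Properties.CommutativeSemigroup +-commutativeSemigroup using (x∙yz≈y∙xz)
open import Data.List using (List; []; _∷_; _++_; map; length; replicate)
open import Data.List.Properties using (map-++; map-replicate; length-++)
open import Data.List.Relation.Unary.Any using (Any; here; there)
import Data.List.Relation.Unary.Any.Properties as Any
open import Data.List.Membership.Propositional using (find)
open import Data.List.Membership.Propositional.Properties using (∈-∃++)
open import Data.Product using (Σ; _×_; _,_; proj₂)
open import Data.Sum using (_⊎_; inj₁; inj₂)
open import Data.Empty using (⊥; ⊥-elim)
open import Level using (Level)
open import Relation.Binary.PropositionalEquality as ≡
  using (_≡_; refl; cong; cong₂; sym; trans; subst)
open import Relation.Binary.Bundles using (Setoid)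
import Data.List.Relation.Binary.Permutation.Setoid as Permutation
import Data.List.Relation.Binary.Permutation.Setoid.Properties as PermutationProperties
import Algebra.Solver.CommutativeMonoid as CommutativeMonoidSolver

mutual
  renT≡subT : ∀ ρ t → renT ρ t ≡ subT (λ x → var (ρ x)) t
  renT≡subT ρ (var x)   = refl
  renT≡subT ρ (fn g ts) = cong (fn g) (renTs≡subTs ρ ts)

  renTs≡subTs : ∀ ρ ts → renTs ρ ts ≡ subTs (λ x → var (ρ x)) ts
  renTs≡subTs ρ []       = refl
  renTs≡subTs ρ (t ∷ ts) = cong₂ _∷_ (renT≡subT ρ t) (renTs≡subTs ρ ts)

mutual
  subT-cong : ∀ {σ τ} → (∀ x → σ x ≡ τ x) → ∀ t → subT σ t ≡ subT τ t
  subT-cong eq (var x)   = eq x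
  subT-cong eq (fn g ts) = cong (fn g) (subTs-cong eq ts)

  subTs-cong : ∀ {σ τ} → (∀ x → σ x ≡ τ x) → ∀ ts → subTs σ ts ≡ subTs τ ts
  subTs-cong eq []       = refl
  subTs-cong eq (t ∷ ts) = cong₂ _∷_ (subT-cong eq t) (subTs-cong eq ts)

mutual
  subT-∘ : ∀ σ τ t → subT σ (subT τ t) ≡ subT (λ x → subT σ (τ x)) t
  subT-∘ σ τ (var x)   = refl
  subT-∘ σ τ (fn g ts) = cong (fn g) (subTs-∘ σ τ ts)

  subTs-∘ : ∀ σ τ ts → subTs σ (subTs τ ts) ≡ subTs (λ x → subT σ (τ x)) ts
  subTs-∘ σ τ []       = refl
  subTs-∘ σ τ (t ∷ ts) = cong₂ _∷_ (subT-∘ σ τ t) (subTs-∘ σ τ ts)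

mutual
  subT-var : ∀ t → subT var t ≡ t
  subT-var (var x)   = refl
  subT-var (fn g ts) = cong (fn g) (subTs-var ts)

  subTs-var : ∀ ts → subTs var ts ≡ ts
  subTs-var []       = refl
  subTs-var (t ∷ ts) = cong₂ _∷_ (subT-var t) (subTs-var ts)

subT-renT-suc : ∀ σ t → subT σ (renT suc t) ≡ subT (λ x → σ (suc x)) t
subT-renT-suc σ t = trans (cong (subT σ) (renT≡subT suc t)) (subT-∘ σ _ t)

renT-suc-subT : ∀ σ t → renT suc (subT σ t) ≡ subT (λ x → renT suc (σ x)) t
renT-suc-subT σ t =
  trans (renT≡subT suc (subT σ t))
        (trans (subT-∘ _ σ t) (subT-cong (λ x → sym (renT≡subT suc (σ x))) t))

liftSub-cong : ∀ {σ τ} → (∀ x → σ x ≡ τ x) → ∀ x → liftSub σ x ≡ liftSub τ x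
liftSub-cong eq zero    = refl
liftSub-cong eq (suc x) = cong (renT suc) (eq x)

liftSub-∘ : ∀ σ τ x → subT (liftSub σ) (liftSub τ x) ≡ liftSub (λ y → subT σ (τ y)) x
liftSub-∘ σ τ zero    = refl
liftSub-∘ σ τ (suc x) = trans (subT-renT-suc (liftSub σ) (τ x)) (sym (renT-suc-subT σ (τ x)))

liftSub-ren : ∀ ρ x → liftSub (λ y → var (ρ y)) x ≡ var (liftRen ρ x)
liftSub-ren ρ zero    = refl
liftSub-ren ρ (suc x) = refl

liftSub-var : ∀ x → liftSub var x ≡ var x
liftSub-var zero    = refl
liftSub-var (suc x) = refl

subT-single : ∀ σ t x → subT σ (single t x) ≡ subT (single (subT σ t)) (liftSub σ x)
subT-single σ t zero    = refl
subT-single σ t (suc x) = sym (trans (subT-renT-suc _ (σ x)) (subT-var (σ x)))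

module CutAdmissibility (ℛ : Set) where
  open MRL ℛ

  subF-cong : ∀ {σ τ} → (∀ x → σ x ≡ τ x) → ∀ A → subF σ A ≡ subF τ A
  subF-cong eq (atom p ts)   = cong (atom p) (subTs-cong eq ts)
  subF-cong eq (neg f A)     = cong (neg f) (subF-cong eq A)
  subF-cong eq (conj 𝒰 A B)  = cong₂ (conj 𝒰) (subF-cong eq A) (subF-cong eq B)
  subF-cong eq (imp f 𝒰 A B) = cong₂ (imp f 𝒰) (subF-cong eq A) (subF-cong eq B)
  subF-cong eq (all 𝒰 A)     = cong (all 𝒰) (subF-cong (liftSub-cong eq) A)

  renF≡subF : ∀ ρ A → renF ρ A ≡ subF (λ x → var (ρ x)) A
  renF≡subF ρ (atom p ts)   = cong (atom p) (renTs≡subTs ρ ts)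
  renF≡subF ρ (neg f A)     = cong (neg f) (renF≡subF ρ A)
  renF≡subF ρ (conj 𝒰 A B)  = cong₂ (conj 𝒰) (renF≡subF ρ A) (renF≡subF ρ B)
  renF≡subF ρ (imp f 𝒰 A B) = cong₂ (imp f 𝒰) (renF≡subF ρ A) (renF≡subF ρ B)
  renF≡subF ρ (all 𝒰 A)     =
    cong (all 𝒰) (trans (renF≡subF (liftRen ρ) A) (sym (subF-cong (liftSub-ren ρ) A)))

  subF-∘ : ∀ σ τ A → subF σ (subF τ A) ≡ subF (λ x → subT σ (τ x)) A
  subF-∘ σ τ (atom p ts)   = cong (atom p) (subTs-∘ σ τ ts)
  subF-∘ σ τ (neg f A)     = cong (neg f) (subF-∘ σ τ A)
  subF-∘ σ τ (conj 𝒰 A B)  = cong₂ (conj 𝒰) (subF-∘ σ τ A) (subF-∘ σ τ B)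
  subF-∘ σ τ (imp f 𝒰 A B) = cong₂ (imp f 𝒰) (subF-∘ σ τ A) (subF-∘ σ τ B)
  subF-∘ σ τ (all 𝒰 A)     =
    cong (all 𝒰) (trans (subF-∘ (liftSub σ) (liftSub τ) A) (subF-cong (liftSub-∘ σ τ) A))

  subF-var : ∀ A → subF var A ≡ A
  subF-var (atom p ts)   = cong (atom p) (subTs-var ts)
  subF-var (neg f A)     = cong (neg f) (subF-var A)
  subF-var (conj 𝒰 A B)  = cong₂ (conj 𝒰) (subF-var A) (subF-var B)
  subF-var (imp f 𝒰 A B) = cong₂ (imp f 𝒰) (subF-var A) (subF-var B)
  subF-var (all 𝒰 A)     = cong (all 𝒰) (trans (subF-cong liftSub-var A) (subF-var A))

  subF-renF-suc : ∀ σ A → subF σ (renF suc A) ≡ subF (λ x → σ (suc x)) A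
  subF-renF-suc σ A = trans (cong (subF σ) (renF≡subF suc A)) (subF-∘ σ _ A)

  subF-liftSub-renF-suc : ∀ σ A → subF (liftSub σ) (renF suc A) ≡ renF suc (subF σ A)
  subF-liftSub-renF-suc σ A =
    trans (subF-renF-suc (liftSub σ) A)
          (sym (trans (renF≡subF suc (subF σ A))
                      (trans (subF-∘ _ σ A) (subF-cong (λ x → sym (renT≡subT suc (σ x))) A))))

  [0:=]-renF-suc : ∀ t A → (renF suc A) [0:= t ] ≡ A
  [0:=]-renF-suc t A = trans (subF-renF-suc (single t) A) (subF-var A)

  subF-[0:=] : ∀ σ t A → subF σ (A [0:= t ]) ≡ (subF (liftSub σ) A) [0:= subT σ t ]
  subF-[0:=] σ t A =
    trans (subF-∘ σ (single t) A)
          (sym (trans (subF-∘ (single (subT σ t)) (liftSub σ) A)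
                      (subF-cong (λ x → sym (subT-single σ t x)) A)))

  size : Formula → ℕ
  size (atom p ts)   = 0
  size (neg f A)     = suc (size A)
  size (conj 𝒰 A B)  = suc (size A + size B)
  size (imp f 𝒰 A B) = suc (size A + size B)
  size (all 𝒰 A)     = suc (size A)

  size-subF : ∀ σ A → size (subF σ A) ≡ size A
  size-subF σ (atom p ts)   = refl
  size-subF σ (neg f A)     = cong suc (size-subF σ A)
  size-subF σ (conj 𝒰 A B)  = cong suc (cong₂ _+_ (size-subF σ A) (size-subF σ B))
  size-subF σ (imp f 𝒰 A B) = cong suc (cong₂ _+_ (size-subF σ A) (size-subF σ B))
  size-subF σ (all 𝒰 A)     = cong suc (size-subF (liftSub σ) A)

  size-renF-suc : ∀ A → size (renF suc A) ≡ size A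
  size-renF-suc A = trans (cong size (renF≡subF suc A)) (size-subF _ A)

  ≈ᵢ-setoid : Setoid (Level.suc Level.zero) (Level.suc Level.zero)
  ≈ᵢ-setoid = record
    { Carrier       = IFormula
    ; _≈_           = _≈ᵢ_
    ; isEquivalence = record
      { refl  = (λ r → refl) , refl
      ; sym   = λ { (e , f) → (λ r → sym (e r)) , sym f }
      ; trans = λ { (e , f) (e′ , f′) → (λ r → trans (e r) (e′ r)) , trans f f′ }
      }
    }

  open Setoid ≈ᵢ-setoid using () renaming (refl to ≈ᵢ-refl; sym to ≈ᵢ-sym; trans to ≈ᵢ-trans)
  open Permutation ≈ᵢ-setoid using (_↭_; ↭-refl; ↭-sym; ↭-trans; ↭-reflexive; ↭-prep; ↭-swap; prep)
  open PermutationProperties ≈ᵢ-setoid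
    using (++-commutativeMonoid; ++⁺; ++⁺ˡ; ++⁺ʳ; ↭-shift; drop-∷; map⁺; Any-resp-↭; ++-comm; ∷↭∷ʳ)
  open CommutativeMonoidSolver ++-commutativeMonoid using (solve; _⊜_; _⊕_)

  ∷↭++∷ : ∀ x Γ Δ → x ∷ Γ ++ Δ ↭ Γ ++ x ∷ Δ
  ∷↭++∷ x Γ Δ = ↭-sym (↭-shift Γ Δ)

  -- Derivations of bounded height, with the principal formula in front

  atomᵢ : ℕ → List Term → Subset → IFormula
  atomᵢ p ts R = [ R ] atom p ts

  infix 3 ⊢[_]_ ⊢′_

  data ⊢[_]_ : ℕ → Sequent → Set₁ where
    Idʰ : ∀ {n Δ} Γ p ts Rs → 1 ≤ length Rs → Partition Rs →
          Δ ↭ Γ ++ map (atomᵢ p ts) Rs → ⊢[ n ] Δ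
    contractionʰ : ∀ {n Δ Γ x} → ⊢[ n ] x ∷ x ∷ Γ → Δ ↭ x ∷ Γ → ⊢[ suc n ] Δ
    ¬-ruleʰ : ∀ {n Δ Γ R f A} → ⊢[ n ] [ pre f R ] A ∷ Γ → Δ ↭ [ R ] neg f A ∷ Γ → ⊢[ suc n ] Δ
    ∧-neg₁ʰ : ∀ {n Δ Γ R 𝒰 A B} → R ∉ 𝒰 → ⊢[ n ] [ R ] A ∷ Γ →
              Δ ↭ [ R ] conj 𝒰 A B ∷ Γ → ⊢[ suc n ] Δ
    ∧-neg₂ʰ : ∀ {n Δ Γ R 𝒰 A B} → R ∉ 𝒰 → ⊢[ n ] [ R ] B ∷ Γ →
              Δ ↭ [ R ] conj 𝒰 A B ∷ Γ → ⊢[ suc n ] Δ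
    ∧-posʰ : ∀ {n Δ Γ R 𝒰 A B} → R ∈ 𝒰 → ⊢[ n ] [ R ] A ∷ Γ → ⊢[ n ] [ R ] B ∷ Γ →
             Δ ↭ [ R ] conj 𝒰 A B ∷ Γ → ⊢[ suc n ] Δ
    ⊃-negʰ : ∀ {n Δ Γ R f 𝒰 A B} → R ∉ 𝒰 → ⊢[ n ] [ R ] B ∷ [ pre f R ] A ∷ Γ →
             Δ ↭ [ R ] imp f 𝒰 A B ∷ Γ → ⊢[ suc n ] Δ
    ⊃-posʰ : ∀ {n Δ Γ₁ Γ₂ R f 𝒰 A B} → R ∈ 𝒰 → ⊢[ n ] [ pre f R ] A ∷ Γ₁ → ⊢[ n ] [ R ] B ∷ Γ₂ →
             Δ ↭ [ R ] imp f 𝒰 A B ∷ Γ₁ ++ Γ₂ → ⊢[ suc n ] Δ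
    ∀-negʰ : ∀ {n Δ Γ R 𝒰 A} (t : Term) → R ∉ 𝒰 → ⊢[ n ] [ R ] (A [0:= t ]) ∷ Γ →
             Δ ↭ [ R ] all 𝒰 A ∷ Γ → ⊢[ suc n ] Δ
    ∀-posʰ : ∀ {n Δ Γ R 𝒰 A} → R ∈ 𝒰 → ⊢[ n ] [ R ] A ∷ shiftS Γ →
             Δ ↭ [ R ] all 𝒰 A ∷ Γ → ⊢[ suc n ] Δ

  ⊢[]-resp-↭ : ∀ {n Γ Δ} → Γ ↭ Δ → ⊢[ n ] Γ → ⊢[ n ] Δ
  ⊢[]-resp-↭ p (Idʰ Γ q ts Rs l part π)  = Idʰ Γ q ts Rs l part (↭-trans (↭-sym p) π)
  ⊢[]-resp-↭ p (contractionʰ d π)        = contractionʰ d (↭-trans (↭-sym p) π)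
  ⊢[]-resp-↭ p (¬-ruleʰ d π)             = ¬-ruleʰ d (↭-trans (↭-sym p) π)
  ⊢[]-resp-↭ p (∧-neg₁ʰ u d π)           = ∧-neg₁ʰ u d (↭-trans (↭-sym p) π)
  ⊢[]-resp-↭ p (∧-neg₂ʰ u d π)           = ∧-neg₂ʰ u d (↭-trans (↭-sym p) π)
  ⊢[]-resp-↭ p (∧-posʰ u d d′ π)         = ∧-posʰ u d d′ (↭-trans (↭-sym p) π)
  ⊢[]-resp-↭ p (⊃-negʰ u d π)            = ⊃-negʰ u d (↭-trans (↭-sym p) π)
  ⊢[]-resp-↭ p (⊃-posʰ u d d′ π)         = ⊃-posʰ u d d′ (↭-trans (↭-sym p) π)
  ⊢[]-resp-↭ p (∀-negʰ t u d π)          = ∀-negʰ t u d (↭-trans (↭-sym p) π)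
  ⊢[]-resp-↭ p (∀-posʰ u d π)            = ∀-posʰ u d (↭-trans (↭-sym p) π)

  ⊢[]-mono : ∀ {m n Γ} → m ≤ n → ⊢[ m ] Γ → ⊢[ n ] Γ
  ⊢[]-mono m≤n     (Idʰ Γ q ts Rs l part π) = Idʰ Γ q ts Rs l part π
  ⊢[]-mono (s≤s m≤n) (contractionʰ d π)     = contractionʰ (⊢[]-mono m≤n d) π
  ⊢[]-mono (s≤s m≤n) (¬-ruleʰ d π)          = ¬-ruleʰ (⊢[]-mono m≤n d) π
  ⊢[]-mono (s≤s m≤n) (∧-neg₁ʰ u d π)        = ∧-neg₁ʰ u (⊢[]-mono m≤n d) π
  ⊢[]-mono (s≤s m≤n) (∧-neg₂ʰ u d π)        = ∧-neg₂ʰ u (⊢[]-mono m≤n d) π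
  ⊢[]-mono (s≤s m≤n) (∧-posʰ u d d′ π)      = ∧-posʰ u (⊢[]-mono m≤n d) (⊢[]-mono m≤n d′) π
  ⊢[]-mono (s≤s m≤n) (⊃-negʰ u d π)         = ⊃-negʰ u (⊢[]-mono m≤n d) π
  ⊢[]-mono (s≤s m≤n) (⊃-posʰ u d d′ π)      = ⊃-posʰ u (⊢[]-mono m≤n d) (⊢[]-mono m≤n d′) π
  ⊢[]-mono (s≤s m≤n) (∀-negʰ t u d π)       = ∀-negʰ t u (⊢[]-mono m≤n d) π
  ⊢[]-mono (s≤s m≤n) (∀-posʰ u d π)         = ∀-posʰ u (⊢[]-mono m≤n d) π

  ⊢′_ : Sequent → Set₁
  ⊢′ Γ = Σ ℕ λ n → ⊢[ n ] Γ

  infixl 3 _⟫_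
  _⟫_ : ∀ {Γ Δ} → ⊢′ Γ → Γ ↭ Δ → ⊢′ Δ
  (n , d) ⟫ p = n , ⊢[]-resp-↭ p d

  contraction′ : ∀ {x Γ} → ⊢′ x ∷ x ∷ Γ → ⊢′ x ∷ Γ
  contraction′ (n , d) = suc n , contractionʰ d ↭-refl

  ¬-rule′ : ∀ {Γ R f A} → ⊢′ [ pre f R ] A ∷ Γ → ⊢′ [ R ] neg f A ∷ Γ
  ¬-rule′ (n , d) = suc n , ¬-ruleʰ d ↭-refl

  ∧-neg₁′ : ∀ {Γ R 𝒰 A B} → R ∉ 𝒰 → ⊢′ [ R ] A ∷ Γ → ⊢′ [ R ] conj 𝒰 A B ∷ Γ
  ∧-neg₁′ u (n , d) = suc n , ∧-neg₁ʰ u d ↭-refl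

  ∧-neg₂′ : ∀ {Γ R 𝒰 A B} → R ∉ 𝒰 → ⊢′ [ R ] B ∷ Γ → ⊢′ [ R ] conj 𝒰 A B ∷ Γ
  ∧-neg₂′ u (n , d) = suc n , ∧-neg₂ʰ u d ↭-refl

  ∧-pos′ : ∀ {Γ R 𝒰 A B} → R ∈ 𝒰 → ⊢′ [ R ] A ∷ Γ → ⊢′ [ R ] B ∷ Γ → ⊢′ [ R ] conj 𝒰 A B ∷ Γ
  ∧-pos′ u (n , d) (m , d′) =
    suc (n ⊔ m) , ∧-posʰ u (⊢[]-mono (m≤m⊔n n m) d) (⊢[]-mono (m≤n⊔m n m) d′) ↭-refl

  ⊃-neg′ : ∀ {Γ R f 𝒰 A B} → R ∉ 𝒰 → ⊢′ [ R ] B ∷ [ pre f R ] A ∷ Γ → ⊢′ [ R ] imp f 𝒰 A B ∷ Γ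
  ⊃-neg′ u (n , d) = suc n , ⊃-negʰ u d ↭-refl

  ⊃-pos′ : ∀ {Γ₁ Γ₂ R f 𝒰 A B} → R ∈ 𝒰 → ⊢′ [ pre f R ] A ∷ Γ₁ → ⊢′ [ R ] B ∷ Γ₂ →
           ⊢′ [ R ] imp f 𝒰 A B ∷ Γ₁ ++ Γ₂
  ⊃-pos′ u (n , d) (m , d′) =
    suc (n ⊔ m) , ⊃-posʰ u (⊢[]-mono (m≤m⊔n n m) d) (⊢[]-mono (m≤n⊔m n m) d′) ↭-refl

  ∀-neg′ : ∀ {Γ R 𝒰 A} (t : Term) → R ∉ 𝒰 → ⊢′ [ R ] (A [0:= t ]) ∷ Γ → ⊢′ [ R ] all 𝒰 A ∷ Γ
  ∀-neg′ t u (n , d) = suc n , ∀-negʰ t u d ↭-refl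

  ∀-pos′ : ∀ {Γ R 𝒰 A} → R ∈ 𝒰 → ⊢′ [ R ] A ∷ shiftS Γ → ⊢′ [ R ] all 𝒰 A ∷ Γ
  ∀-pos′ u (n , d) = suc n , ∀-posʰ u d ↭-refl

  ∷∷↭,,,, : ∀ x y Γ → x ∷ y ∷ Γ ↭ Γ ,, y ,, x
  ∷∷↭,,,, x y Γ = solve 3 (λ X Y G → X ⊕ (Y ⊕ G) ⊜ (G ⊕ Y) ⊕ X) ↭-refl (x ∷ []) (y ∷ []) Γ

  ⊢[]⇒⊢ : ∀ {n Γ} → ⊢[ n ] Γ → ⊢ Γ
  ⊢[]⇒⊢ (Idʰ Γ q ts Rs l part π) = perm (↭-sym π) (Id Γ q ts Rs l part)
  ⊢[]⇒⊢ (contractionʰ {Γ = Γ} d π) =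
    perm (↭-sym (↭-trans π (∷↭∷ʳ _ Γ))) (contraction (perm (∷∷↭,,,, _ _ Γ) (⊢[]⇒⊢ d)))
  ⊢[]⇒⊢ (¬-ruleʰ {Γ = Γ} d π) =
    perm (↭-sym (↭-trans π (∷↭∷ʳ _ Γ))) (¬-rule (perm (∷↭∷ʳ _ Γ) (⊢[]⇒⊢ d)))
  ⊢[]⇒⊢ (∧-neg₁ʰ {Γ = Γ} u d π) =
    perm (↭-sym (↭-trans π (∷↭∷ʳ _ Γ))) (∧-neg₁ u (perm (∷↭∷ʳ _ Γ) (⊢[]⇒⊢ d)))
  ⊢[]⇒⊢ (∧-neg₂ʰ {Γ = Γ} u d π) =
    perm (↭-sym (↭-trans π (∷↭∷ʳ _ Γ))) (∧-neg₂ u (perm (∷↭∷ʳ _ Γ) (⊢[]⇒⊢ d)))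
  ⊢[]⇒⊢ (∧-posʰ {Γ = Γ} u d d′ π) =
    perm (↭-sym (↭-trans π (∷↭∷ʳ _ Γ)))
         (∧-pos u (perm (∷↭∷ʳ _ Γ) (⊢[]⇒⊢ d)) (perm (∷↭∷ʳ _ Γ) (⊢[]⇒⊢ d′)))
  ⊢[]⇒⊢ (⊃-negʰ {Γ = Γ} u d π) =
    perm (↭-sym (↭-trans π (∷↭∷ʳ _ Γ))) (⊃-neg u (perm (∷∷↭,,,, _ _ Γ) (⊢[]⇒⊢ d)))
  ⊢[]⇒⊢ (⊃-posʰ {Γ₁ = Γ₁} {Γ₂} u d d′ π) =
    perm (↭-sym (↭-trans π (∷↭∷ʳ _ (Γ₁ ++ Γ₂))))
         (⊃-pos u (perm (∷↭∷ʳ _ Γ₁) (⊢[]⇒⊢ d)) (perm (∷↭∷ʳ _ Γ₂) (⊢[]⇒⊢ d′)))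
  ⊢[]⇒⊢ (∀-negʰ {Γ = Γ} t u d π) =
    perm (↭-sym (↭-trans π (∷↭∷ʳ _ Γ))) (∀-neg t u (perm (∷↭∷ʳ _ Γ) (⊢[]⇒⊢ d)))
  ⊢[]⇒⊢ (∀-posʰ {Γ = Γ} u d π) =
    perm (↭-sym (↭-trans π (∷↭∷ʳ _ Γ))) (∀-pos u (perm (∷↭∷ʳ _ (shiftS Γ)) (⊢[]⇒⊢ d)))

  ⊢⇒⊢′ : ∀ {Γ} → ⊢ Γ → ⊢′ Γ
  ⊢⇒⊢′ (perm p d)            = ⊢⇒⊢′ d ⟫ p
  ⊢⇒⊢′ (Id Γ p ts Rs l part) = 0 , Idʰ Γ p ts Rs l part ↭-refl
  ⊢⇒⊢′ (contraction {Γ} d)   = contraction′ (⊢⇒⊢′ d ⟫ ↭-sym (∷∷↭,,,, _ _ Γ)) ⟫ ∷↭∷ʳ _ Γ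
  ⊢⇒⊢′ (¬-rule {Γ} d)        = ¬-rule′ (⊢⇒⊢′ d ⟫ ↭-sym (∷↭∷ʳ _ Γ)) ⟫ ∷↭∷ʳ _ Γ
  ⊢⇒⊢′ (∧-neg₁ {Γ} u d)      = ∧-neg₁′ u (⊢⇒⊢′ d ⟫ ↭-sym (∷↭∷ʳ _ Γ)) ⟫ ∷↭∷ʳ _ Γ
  ⊢⇒⊢′ (∧-neg₂ {Γ} u d)      = ∧-neg₂′ u (⊢⇒⊢′ d ⟫ ↭-sym (∷↭∷ʳ _ Γ)) ⟫ ∷↭∷ʳ _ Γ
  ⊢⇒⊢′ (∧-pos {Γ} u d d′)    =
    ∧-pos′ u (⊢⇒⊢′ d ⟫ ↭-sym (∷↭∷ʳ _ Γ)) (⊢⇒⊢′ d′ ⟫ ↭-sym (∷↭∷ʳ _ Γ)) ⟫ ∷↭∷ʳ _ Γ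
  ⊢⇒⊢′ (⊃-neg {Γ} u d)       = ⊃-neg′ u (⊢⇒⊢′ d ⟫ ↭-sym (∷∷↭,,,, _ _ Γ)) ⟫ ∷↭∷ʳ _ Γ
  ⊢⇒⊢′ (⊃-pos {Γ₁} {Γ₂} u d d′) =
    ⊃-pos′ u (⊢⇒⊢′ d ⟫ ↭-sym (∷↭∷ʳ _ Γ₁)) (⊢⇒⊢′ d′ ⟫ ↭-sym (∷↭∷ʳ _ Γ₂)) ⟫ ∷↭∷ʳ _ (Γ₁ ++ Γ₂)
  ⊢⇒⊢′ (∀-neg {Γ} t u d)     = ∀-neg′ t u (⊢⇒⊢′ d ⟫ ↭-sym (∷↭∷ʳ _ Γ)) ⟫ ∷↭∷ʳ _ Γ
  ⊢⇒⊢′ (∀-pos {Γ} u d)       = ∀-pos′ u (⊢⇒⊢′ d ⟫ ↭-sym (∷↭∷ʳ _ (shiftS Γ))) ⟫ ∷↭∷ʳ _ Γ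

  subI : (ℕ → Term) → IFormula → IFormula
  subI σ ([ R ] A) = [ R ] subF σ A

  subS : (ℕ → Term) → Sequent → Sequent
  subS σ = map (subI σ)

  shiftI : IFormula → IFormula
  shiftI ([ R ] A) = [ R ] renF suc A

  subS-resp-↭ : ∀ σ {Γ Δ} → Γ ↭ Δ → subS σ Γ ↭ subS σ Δ
  subS-resp-↭ σ = map⁺ ≈ᵢ-setoid (λ { (e , f) → e , cong (subF σ) f })

  shiftS-resp-↭ : ∀ {Γ Δ} → Γ ↭ Δ → shiftS Γ ↭ shiftS Δ
  shiftS-resp-↭ = map⁺ ≈ᵢ-setoid (λ { (e , f) → e , cong (renF suc) f })

  subS-atoms : ∀ σ p ts Rs → subS σ (map (atomᵢ p ts) Rs) ≡ map (atomᵢ p (subTs σ ts)) Rs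
  subS-atoms σ p ts []       = refl
  subS-atoms σ p ts (R ∷ Rs) = cong (_ ∷_) (subS-atoms σ p ts Rs)

  subS-liftSub-shiftS : ∀ σ Γ → subS (liftSub σ) (shiftS Γ) ≡ shiftS (subS σ Γ)
  subS-liftSub-shiftS σ []      = refl
  subS-liftSub-shiftS σ (([ R ] A) ∷ Γ) =
    cong₂ _∷_ (cong ([ R ]_) (subF-liftSub-renF-suc σ A)) (subS-liftSub-shiftS σ Γ)

  shiftS≡subS : ∀ Γ → shiftS Γ ≡ subS (λ x → var (suc x)) Γ
  shiftS≡subS []      = refl
  shiftS≡subS (([ R ] A) ∷ Γ) = cong₂ _∷_ (cong ([ R ]_) (renF≡subF suc A)) (shiftS≡subS Γ)

  subS-single-shiftS : ∀ t Γ → subS (single t) (shiftS Γ) ≡ Γ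
  subS-single-shiftS t []      = refl
  subS-single-shiftS t (([ R ] A) ∷ Γ) =
    cong₂ _∷_ (cong ([ R ]_) ([0:=]-renF-suc t A)) (subS-single-shiftS t Γ)

  shiftS-replicate-++ : ∀ k x Γ → shiftS (replicate k x ++ Γ) ≡ replicate k (shiftI x) ++ shiftS Γ
  shiftS-replicate-++ k x Γ =
    trans (map-++ shiftI (replicate k x) Γ) (cong (_++ shiftS Γ) (map-replicate shiftI k x))

  shiftS-↭-replicate-++ : ∀ k {x Γ Γ₁} → Γ ↭ replicate k x ++ Γ₁ →
                          shiftS Γ ↭ replicate k (shiftI x) ++ shiftS Γ₁
  shiftS-↭-replicate-++ k {x} {Γ₁ = Γ₁} q =
    ↭-trans (shiftS-resp-↭ q) (↭-reflexive (shiftS-replicate-++ k x Γ₁))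

  ⊢[]-subst : ∀ σ {n Γ} → ⊢[ n ] Γ → ⊢[ n ] subS σ Γ
  ⊢[]-subst σ (Idʰ Γ p ts Rs l part π) =
    Idʰ (subS σ Γ) p (subTs σ ts) Rs l part
        (↭-trans (subS-resp-↭ σ π)
                 (↭-reflexive (trans (map-++ (subI σ) Γ _) (cong (subS σ Γ ++_) (subS-atoms σ p ts Rs)))))
  ⊢[]-subst σ (contractionʰ d π) = contractionʰ (⊢[]-subst σ d) (subS-resp-↭ σ π)
  ⊢[]-subst σ (¬-ruleʰ d π)      = ¬-ruleʰ (⊢[]-subst σ d) (subS-resp-↭ σ π)
  ⊢[]-subst σ (∧-neg₁ʰ u d π)    = ∧-neg₁ʰ u (⊢[]-subst σ d) (subS-resp-↭ σ π)
  ⊢[]-subst σ (∧-neg₂ʰ u d π)    = ∧-neg₂ʰ u (⊢[]-subst σ d) (subS-resp-↭ σ π)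
  ⊢[]-subst σ (∧-posʰ u d d′ π)  = ∧-posʰ u (⊢[]-subst σ d) (⊢[]-subst σ d′) (subS-resp-↭ σ π)
  ⊢[]-subst σ (⊃-negʰ u d π)     = ⊃-negʰ u (⊢[]-subst σ d) (subS-resp-↭ σ π)
  ⊢[]-subst σ (⊃-posʰ {Γ₁ = Γ₁} {Γ₂} u d d′ π) =
    ⊃-posʰ u (⊢[]-subst σ d) (⊢[]-subst σ d′)
           (↭-trans (subS-resp-↭ σ π) (↭-reflexive (cong (_ ∷_) (map-++ (subI σ) Γ₁ Γ₂))))
  ⊢[]-subst σ (∀-negʰ {Γ = Γ} {R} {A = A} t u d π) =
    ∀-negʰ (subT σ t) u (subst (λ B → ⊢[ _ ] [ R ] B ∷ subS σ Γ) (subF-[0:=] σ t A) (⊢[]-subst σ d))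
           (subS-resp-↭ σ π)
  ⊢[]-subst σ (∀-posʰ {Γ = Γ} {R} {A = A} u d π) =
    ∀-posʰ u (subst (λ Θ → ⊢[ _ ] [ R ] subF (liftSub σ) A ∷ Θ) (subS-liftSub-shiftS σ Γ)
                    (⊢[]-subst (liftSub σ) d))
           (subS-resp-↭ σ π)

  ⊢[]-shift : ∀ {n Γ} → ⊢[ n ] Γ → ⊢[ n ] shiftS Γ
  ⊢[]-shift {n} {Γ} d = subst (⊢[ n ]_) (sym (shiftS≡subS Γ)) (⊢[]-subst _ d)

  ⊢′-instantiate : ∀ t x y Γ → ⊢′ shiftI x ∷ y ∷ shiftS Γ → ⊢′ x ∷ subI (single t) y ∷ Γ
  ⊢′-instantiate t ([ R ] A) y Γ (n , d) =
    n , subst (⊢[ n ]_) (cong₂ _∷_ (cong ([ R ]_) ([0:=]-renF-suc t A)) (cong (_ ∷_) (subS-single-shiftS t Γ)))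
              (⊢[]-subst (single t) d)

  Any-≈⇒↭∷ : ∀ {y} Γ → Any (y ≈ᵢ_) Γ → Σ Sequent λ Γ′ → Γ ↭ y ∷ Γ′
  Any-≈⇒↭∷ (z ∷ Γ) (here e)  = Γ , prep (≈ᵢ-sym e) ↭-refl
  Any-≈⇒↭∷ (z ∷ Γ) (there a) with Any-≈⇒↭∷ Γ a
  ... | Γ′ , p = z ∷ Γ′ , ↭-trans (↭-prep z p) (↭-swap z _ ↭-refl)

  ↭∷⇒Any-≈ : ∀ {y Γ Δ} → Δ ↭ y ∷ Γ → Any (y ≈ᵢ_) Δ
  ↭∷⇒Any-≈ π = Any-resp-↭ (λ x≈y y≈z → ≈ᵢ-trans y≈z x≈y) (↭-sym π) (here ≈ᵢ-refl)

  Any-replicate-++⁻ : ∀ {P : IFormula → Set₁} k x Γ → Any P (replicate k x ++ Γ) →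
                      (Σ ℕ λ k′ → k ≡ suc k′ × P x) ⊎ Any P Γ
  Any-replicate-++⁻ zero    x Γ a         = inj₂ a
  Any-replicate-++⁻ (suc k) x Γ (here p)  = inj₁ (k , refl , p)
  Any-replicate-++⁻ (suc k) x Γ (there a) with Any-replicate-++⁻ k x Γ a
  ... | inj₁ (k′ , refl , p) = inj₁ (suc k′ , refl , p)
  ... | inj₂ b               = inj₂ b

  ↭-copies-∷ : ∀ k x Γ₁ {y Γ} → replicate k x ++ Γ₁ ↭ y ∷ Γ →
    (Σ ℕ λ k′ → k ≡ suc k′ × y ≈ᵢ x × Γ ↭ replicate k′ x ++ Γ₁) ⊎
    (Σ Sequent λ Γ₁′ → Γ₁ ↭ y ∷ Γ₁′ × Γ ↭ replicate k x ++ Γ₁′)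
  ↭-copies-∷ k x Γ₁ {y} {Γ} π with Any-replicate-++⁻ k x Γ₁ (↭∷⇒Any-≈ π)
  ... | inj₁ (k′ , refl , e) = inj₁ (k′ , refl , e , drop-∷ (↭-trans (↭-sym π) (prep (≈ᵢ-sym e) ↭-refl)))
  ... | inj₂ a with Any-≈⇒↭∷ Γ₁ a
  ... | Γ₁′ , p = inj₂ (Γ₁′ , p , drop-∷ (↭-trans (↭-sym π)
                                   (↭-trans (++⁺ˡ (replicate k x) p) (↭-shift (replicate k x) Γ₁′))))

  ↭-copies-++ : ∀ k x Γ′ Γa Γb → Γa ++ Γb ↭ replicate k x ++ Γ′ →
    Σ ℕ λ ka → Σ ℕ λ kb → Σ Sequent λ Γa′ → Σ Sequent λ Γb′ →
      (Γa ↭ replicate ka x ++ Γa′) × (Γb ↭ replicate kb x ++ Γb′) × (Γ′ ↭ Γa′ ++ Γb′)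
  ↭-copies-++ zero x Γ′ Γa Γb π = 0 , 0 , Γa , Γb , ↭-refl , ↭-refl , ↭-sym π
  ↭-copies-++ (suc k) x Γ′ Γa Γb π with Any.++⁻ Γa (↭∷⇒Any-≈ π)
  ... | inj₁ a with Any-≈⇒↭∷ Γa a
  ... | Γa₀ , p with ↭-copies-++ k x Γ′ Γa₀ Γb (drop-∷ (↭-trans (↭-sym (++⁺ʳ Γb p)) π))
  ... | ka , kb , Γa′ , Γb′ , pa , pb , q = suc ka , kb , Γa′ , Γb′ , ↭-trans p (↭-prep x pa) , pb , q
  ↭-copies-++ (suc k) x Γ′ Γa Γb π | inj₂ b with Any-≈⇒↭∷ Γb b
  ... | Γb₀ , p with ↭-copies-++ k x Γ′ Γa Γb₀
                       (drop-∷ (↭-trans (∷↭++∷ x Γa Γb₀) (↭-trans (↭-sym (++⁺ˡ Γa p)) π)))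
  ... | ka , kb , Γa′ , Γb′ , pa , pb , q = ka , suc kb , Γa′ , Γb′ , pa , ↭-trans p (↭-prep x pb) , q

  contract-++ : ∀ Γ {Δ} → ⊢′ Γ ++ Γ ++ Δ → ⊢′ Γ ++ Δ
  contract-++ []      d = d
  contract-++ (y ∷ Γ) {Δ} d =
    contract-++ Γ (contraction′ (d ⟫ ↭-prep y (↭-sym (∷↭++∷ y Γ (Γ ++ Δ))))
                   ⟫ ↭-trans (∷↭++∷ y Γ (Γ ++ Δ)) (++⁺ˡ Γ (∷↭++∷ y Γ Δ)))
    ⟫ ↭-sym (∷↭++∷ y Γ Δ)

  Covers : Subset → Subset → Set
  Covers R₁ R₂ = ∀ r → (∁ R₁ ∩ ∁ R₂) r ≡ false

  Covers-sym : ∀ {R R′} → Covers R R′ → Covers R′ R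
  Covers-sym {R} {R′} c r = trans (∧-comm (not (R′ r)) (not (R r))) (c r)

  Covers-pre : ∀ {R R′} f → Covers R R′ → Covers (pre f R) (pre f R′)
  Covers-pre f c r = c (f r)

  ∩-comm : ∀ R R′ → (R ∩ R′) ≐ (R′ ∩ R)
  ∩-comm R R′ r = ∧-comm (R r) (R′ r)

  ∈-resp-≐ : ∀ 𝒰 {R R′} → R ≐ R′ → R ∈ 𝒰 → R′ ∈ 𝒰
  ∈-resp-≐ 𝒰 e m = up-closed 𝒰 m (λ r h → trans (sym (e r)) h)

  ∉-resp-≐ : ∀ 𝒰 {R R′} → R ≐ R′ → R ∉ 𝒰 → R′ ∉ 𝒰
  ∉-resp-≐ 𝒰 e n m = n (∈-resp-≐ 𝒰 (λ r → sym (e r)) m)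

  ∩-∉ˡ : ∀ 𝒰 {R R′} → R ∉ 𝒰 → (R ∩ R′) ∉ 𝒰
  ∩-∉ˡ 𝒰 {R} {R′} n m = n (up-closed 𝒰 m (λ r → ∧-conicalˡ (R r) (R′ r)))

  ∩-∉ʳ : ∀ 𝒰 {R R′} → R′ ∉ 𝒰 → (R ∩ R′) ∉ 𝒰
  ∩-∉ʳ 𝒰 {R} {R′} n m = n (up-closed 𝒰 m (λ r → ∧-conicalʳ (R r) (R′ r)))

  -- Otherwise ∁ R ∩ ∁ R′ ∈ 𝒰, and this empty set lies below R.
  Covers⇒¬both∉ : ∀ 𝒰 {R R′} → Covers R R′ → R ∉ 𝒰 → R′ ∉ 𝒰 → ⊥
  Covers⇒¬both∉ 𝒰 {R} {R′} c n n′ with ultra 𝒰 R | ultra 𝒰 R′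
  ... | inj₁ m | _      = n m
  ... | _      | inj₁ m = n′ m
  ... | inj₂ a | inj₂ b = n (up-closed 𝒰 (∩-closed 𝒰 a b) (λ r h → ⊥-elim (true≢false (trans (sym h) (c r)))))
    where
      true≢false : true ≡ false → ⊥
      true≢false ()

  count : Bool → ℕ → ℕ
  count b j = if b then j else 0

  hits-∷ : ∀ r R Rs → hits r (R ∷ Rs) ≡ count (R r) 1 + hits r Rs
  hits-∷ r R Rs with R r
  ... | true  = refl
  ... | false = refl

  hits-++ : ∀ r Rs Ss → hits r (Rs ++ Ss) ≡ hits r Rs + hits r Ss
  hits-++ r []       Ss = refl
  hits-++ r (R ∷ Rs) Ss = begin
    hits r (R ∷ Rs ++ Ss)                   ≡⟨ hits-∷ r R (Rs ++ Ss) ⟩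
    count (R r) 1 + hits r (Rs ++ Ss)       ≡⟨ cong (count (R r) 1 +_) (hits-++ r Rs Ss) ⟩
    count (R r) 1 + (hits r Rs + hits r Ss) ≡⟨ sym (+-assoc (count (R r) 1) _ _) ⟩
    count (R r) 1 + hits r Rs + hits r Ss   ≡⟨ cong (_+ hits r Ss) (sym (hits-∷ r R Rs)) ⟩
    hits r (R ∷ Rs) + hits r Ss             ∎
    where open ≡.≡-Reasoning

  count-zero : ∀ b → count b 0 ≡ 0
  count-zero true  = refl
  count-zero false = refl

  count-suc : ∀ b j → count b (suc j) ≡ count b 1 + count b j
  count-suc true  j = refl
  count-suc false j = refl

  +-count-suc≡1 : ∀ b m j → m + count b (suc j) ≡ 1 → count b 1 + m ≡ 1
  +-count-suc≡1 true  m j e = cong suc (m+n≡0⇒m≡0 m (suc-injective (trans (sym (+-suc m j)) e)))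
  +-count-suc≡1 false m j e = trans (sym (+-identityʳ m)) e

  -- The copies of [ R₁ ] A found among the atoms of the axiom are j members of Rs, each ≐ R₁.
  Id-copies : ∀ k R₁ A Γ₁ Γ p ts Rs → replicate k ([ R₁ ] A) ++ Γ₁ ↭ Γ ++ map (atomᵢ p ts) Rs →
    Σ ℕ λ j → Σ Sequent λ Γ′ → Σ (List Subset) λ Ss →
      (Γ₁ ↭ Γ′ ++ map (atomᵢ p ts) Ss) × (∀ r → hits r Rs ≡ hits r Ss + count (R₁ r) j) ×
      (length Rs ≡ length Ss + j) × (j ≡ 0 ⊎ A ≡ atom p ts)
  Id-copies zero R₁ A Γ₁ Γ p ts Rs π =
    0 , Γ , Rs , π , (λ r → sym (trans (cong (hits r Rs +_) (count-zero (R₁ r))) (+-identityʳ _))) ,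
    sym (+-identityʳ _) , inj₁ refl
  Id-copies (suc k) R₁ A Γ₁ Γ p ts Rs π with Any.++⁻ Γ (↭∷⇒Any-≈ (↭-sym π))
  ... | inj₁ a with Any-≈⇒↭∷ Γ a
  ... | Γ₀ , q = Id-copies k R₁ A Γ₁ Γ₀ p ts Rs (drop-∷ (↭-trans π (++⁺ʳ _ q)))
  Id-copies (suc k) R₁ A Γ₁ Γ p ts Rs π | inj₂ a with find (Any.map⁻ a)
  ... | R , R∈Rs , (e , f) with ∈-∃++ R∈Rs
  ... | as , bs , refl with Id-copies k R₁ A Γ₁ Γ p ts (as ++ bs) (drop-∷ (↭-trans π removeR))
    where
      at = atomᵢ p ts
      removeR : Γ ++ map at (as ++ R ∷ bs) ↭ [ R₁ ] A ∷ Γ ++ map at (as ++ bs)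
      removeR =
        ↭-trans (↭-reflexive (cong (Γ ++_) (map-++ at as (R ∷ bs))))
        (↭-trans (++⁺ˡ Γ (↭-shift (map at as) (map at bs)))
        (↭-trans (↭-shift Γ (map at as ++ map at bs))
        (↭-trans (↭-reflexive (cong (λ Θ → at R ∷ Γ ++ Θ) (sym (map-++ at as bs))))
                 (prep (≈ᵢ-sym (e , f)) ↭-refl))))
  ... | j , Γ′ , Ss , q , h , l , _ = suc j , Γ′ , Ss , q , hits≡ , length≡ , inj₂ f
    where
      open ≡.≡-Reasoning
      hits≡ : ∀ r → hits r (as ++ R ∷ bs) ≡ hits r Ss + count (R₁ r) (suc j)
      hits≡ r = begin
        hits r (as ++ R ∷ bs)                         ≡⟨ hits-++ r as (R ∷ bs) ⟩
        hits r as + hits r (R ∷ bs)                   ≡⟨ cong (hits r as +_) (hits-∷ r R bs) ⟩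
        hits r as + (count (R r) 1 + hits r bs)       ≡⟨ x∙yz≈y∙xz (hits r as) (count (R r) 1) _ ⟩
        count (R r) 1 + (hits r as + hits r bs)       ≡⟨ cong₂ _+_ (cong (λ b → count b 1) (sym (e r)))
                                                               (sym (hits-++ r as bs)) ⟩
        count (R₁ r) 1 + hits r (as ++ bs)            ≡⟨ cong (count (R₁ r) 1 +_) (h r) ⟩
        count (R₁ r) 1 + (hits r Ss + count (R₁ r) j) ≡⟨ x∙yz≈y∙xz (count (R₁ r) 1) (hits r Ss) _ ⟩
        hits r Ss + (count (R₁ r) 1 + count (R₁ r) j) ≡⟨ cong (hits r Ss +_) (sym (count-suc (R₁ r) j)) ⟩
        hits r Ss + count (R₁ r) (suc j)              ∎
      length≡ : length (as ++ R ∷ bs) ≡ length Ss + suc j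
      length≡ = begin
        length (as ++ R ∷ bs)      ≡⟨ length-++ as ⟩
        length as + suc (length bs) ≡⟨ +-suc (length as) _ ⟩
        suc (length as + length bs) ≡⟨ cong suc (sym (length-++ as)) ⟩
        suc (length (as ++ bs))    ≡⟨ cong suc l ⟩
        suc (length Ss + j)        ≡⟨ sym (+-suc (length Ss) j) ⟩
        length Ss + suc j          ∎

  Id-view : ∀ k R₁ A Γ₁ Γ p ts Rs → replicate k ([ R₁ ] A) ++ Γ₁ ↭ Γ ++ map (atomᵢ p ts) Rs →
            Partition Rs → 1 ≤ length Rs →
    (Σ Sequent λ Γ′ → Σ (List Subset) λ Ss →
       (Γ₁ ↭ Γ′ ++ map (atomᵢ p ts) Ss) × Partition Ss × 1 ≤ length Ss) ⊎
    (A ≡ atom p ts × (Σ Sequent λ Γ′ → Σ (List Subset) λ Ss →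
       (Γ₁ ↭ Γ′ ++ map (atomᵢ p ts) Ss) × Partition (R₁ ∷ Ss)))
  Id-view k R₁ A Γ₁ Γ p ts Rs π part l with Id-copies k R₁ A Γ₁ Γ p ts Rs π
  ... | zero , Γ′ , Ss , q , h , l′ , _ =
    inj₁ (Γ′ , Ss , q , partition , subst (1 ≤_) (trans l′ (+-identityʳ _)) l)
    where
      partition : Partition Ss
      partition r = trans (sym (trans (h r) (trans (cong (hits r Ss +_) (count-zero (R₁ r))) (+-identityʳ _))))
                          (part r)
  ... | suc j , Γ′ , Ss , q , h , l′ , inj₂ f =
    inj₂ (f , Γ′ , Ss , q ,
          λ r → trans (hits-∷ r R₁ Ss) (+-count-suc≡1 (R₁ r) (hits r Ss) j (trans (sym (h r)) (part r))))

  Partition-∩ : ∀ R₁ R₂ Ss Ts → Partition (R₁ ∷ Ss) → Partition (R₂ ∷ Ts) → Covers R₁ R₂ →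
                Partition ((R₁ ∩ R₂) ∷ Ss ++ Ts)
  Partition-∩ R₁ R₂ Ss Ts p q c r =
    trans (hits-∷ r (R₁ ∩ R₂) (Ss ++ Ts))
          (trans (cong (count ((R₁ ∩ R₂) r) 1 +_) (hits-++ r Ss Ts))
                 (cover-count (R₁ r) (R₂ r) (trans (sym (hits-∷ r R₁ Ss)) (p r))
                                            (trans (sym (hits-∷ r R₂ Ts)) (q r)) (c r)))
    where
      cover-count : ∀ a b {m k} → count a 1 + m ≡ 1 → count b 1 + k ≡ 1 → (not a ∧ not b) ≡ false →
                    count (a ∧ b) 1 + (m + k) ≡ 1
      cover-count true  true  refl refl _  = refl
      cover-count true  false refl refl _  = refl
      cover-count false true  refl refl _  = refl
      cover-count false false _    _    ()

  -- Derivations containing k copies of a cut formula, viewed through their last rule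

  infix 3 ⊢[_]⟨_×_⟩_

  data ⊢[_]⟨_×_⟩_ (n k : ℕ) (x : IFormula) (Γ : Sequent) : Set₁ where
    copies : ⊢[ n ] replicate k x ++ Γ → ⊢[ n ]⟨ k × x ⟩ Γ

  ⊢[]⟨⟩-∷ : ∀ {n k x y z Γ Γ₁} → y ≈ᵢ z → Γ ↭ replicate k x ++ Γ₁ → ⊢[ n ] y ∷ Γ → ⊢[ n ]⟨ k × x ⟩ z ∷ Γ₁
  ⊢[]⟨⟩-∷ {k = k} {x} {Γ₁ = Γ₁} e q d =
    copies (⊢[]-resp-↭ (↭-trans (prep e q) (∷↭++∷ _ (replicate k x) Γ₁)) d)

  ⊢[]⟨⟩-∷∷ : ∀ {n k x y y′ z z′ Γ Γ₁} → y ≈ᵢ z → y′ ≈ᵢ z′ → Γ ↭ replicate k x ++ Γ₁ →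
             ⊢[ n ] y ∷ y′ ∷ Γ → ⊢[ n ]⟨ k × x ⟩ z ∷ z′ ∷ Γ₁
  ⊢[]⟨⟩-∷∷ {k = k} {x} {z = z} {z′} {Γ₁ = Γ₁} e e′ q d =
    copies (⊢[]-resp-↭ (↭-trans (prep e (prep e′ q))
                                (solve 3 (λ Z X G → Z ⊕ (X ⊕ G) ⊜ X ⊕ (Z ⊕ G)) ↭-refl
                                         (z ∷ z′ ∷ []) (replicate k x) Γ₁)) d)

  data NonPrincipal : ℕ → ℕ → Subset → Formula → Sequent → Set₁ where
    Idₙ : ∀ {n k R₁ A Γ₁} Γ′ p ts Ss → Γ₁ ↭ Γ′ ++ map (atomᵢ p ts) Ss → Partition Ss → 1 ≤ length Ss →
          NonPrincipal n k R₁ A Γ₁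
    copy-contractionₙ : ∀ {m k R₁ A Γ₁} → ⊢[ m ]⟨ suc (suc k) × [ R₁ ] A ⟩ Γ₁ →
                        NonPrincipal (suc m) (suc k) R₁ A Γ₁
    contractionₙ : ∀ {m k R₁ A Γ₁ Γ₁′ y} → ⊢[ m ]⟨ k × [ R₁ ] A ⟩ y ∷ y ∷ Γ₁′ → Γ₁ ↭ y ∷ Γ₁′ →
                   NonPrincipal (suc m) k R₁ A Γ₁
    ¬-ruleₙ : ∀ {m k R₁ A Γ₁ Γ₁′ R f B} → ⊢[ m ]⟨ k × [ R₁ ] A ⟩ [ pre f R ] B ∷ Γ₁′ →
              Γ₁ ↭ [ R ] neg f B ∷ Γ₁′ → NonPrincipal (suc m) k R₁ A Γ₁
    ∧-neg₁ₙ : ∀ {m k R₁ A Γ₁ Γ₁′ R 𝒰 B C} → R ∉ 𝒰 → ⊢[ m ]⟨ k × [ R₁ ] A ⟩ [ R ] B ∷ Γ₁′ →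
              Γ₁ ↭ [ R ] conj 𝒰 B C ∷ Γ₁′ → NonPrincipal (suc m) k R₁ A Γ₁
    ∧-neg₂ₙ : ∀ {m k R₁ A Γ₁ Γ₁′ R 𝒰 B C} → R ∉ 𝒰 → ⊢[ m ]⟨ k × [ R₁ ] A ⟩ [ R ] C ∷ Γ₁′ →
              Γ₁ ↭ [ R ] conj 𝒰 B C ∷ Γ₁′ → NonPrincipal (suc m) k R₁ A Γ₁
    ∧-posₙ : ∀ {m k R₁ A Γ₁ Γ₁′ R 𝒰 B C} → R ∈ 𝒰 → ⊢[ m ]⟨ k × [ R₁ ] A ⟩ [ R ] B ∷ Γ₁′ →
             ⊢[ m ]⟨ k × [ R₁ ] A ⟩ [ R ] C ∷ Γ₁′ → Γ₁ ↭ [ R ] conj 𝒰 B C ∷ Γ₁′ → NonPrincipal (suc m) k R₁ A Γ₁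
    ⊃-negₙ : ∀ {m k R₁ A Γ₁ Γ₁′ R f 𝒰 B C} → R ∉ 𝒰 → ⊢[ m ]⟨ k × [ R₁ ] A ⟩ [ R ] C ∷ [ pre f R ] B ∷ Γ₁′ →
             Γ₁ ↭ [ R ] imp f 𝒰 B C ∷ Γ₁′ → NonPrincipal (suc m) k R₁ A Γ₁
    ⊃-posₙ : ∀ {m k ka kb R₁ A Γ₁ Γa Γb R f 𝒰 B C} → R ∈ 𝒰 → ⊢[ m ]⟨ ka × [ R₁ ] A ⟩ [ pre f R ] B ∷ Γa →
             ⊢[ m ]⟨ kb × [ R₁ ] A ⟩ [ R ] C ∷ Γb → Γ₁ ↭ [ R ] imp f 𝒰 B C ∷ Γa ++ Γb →
             NonPrincipal (suc m) k R₁ A Γ₁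
    ∀-negₙ : ∀ {m k R₁ A Γ₁ Γ₁′ R 𝒰 B} (t : Term) → R ∉ 𝒰 → ⊢[ m ]⟨ k × [ R₁ ] A ⟩ [ R ] (B [0:= t ]) ∷ Γ₁′ →
             Γ₁ ↭ [ R ] all 𝒰 B ∷ Γ₁′ → NonPrincipal (suc m) k R₁ A Γ₁
    ∀-posₙ : ∀ {m k R₁ A Γ₁ Γ₁′ R 𝒰 B} → R ∈ 𝒰 → ⊢[ m ]⟨ k × [ R₁ ] renF suc A ⟩ [ R ] B ∷ shiftS Γ₁′ →
             Γ₁ ↭ [ R ] all 𝒰 B ∷ Γ₁′ → NonPrincipal (suc m) k R₁ A Γ₁

  -- Besides the premises the whole derivation is kept: a principal reduction mixes each premise
  -- with the whole derivation on the other side.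
  data Principal : ℕ → ℕ → Subset → Formula → Sequent → Set₁ where
    Idₚ : ∀ {n k R₁ p ts Γ₁} Γ′ Ss → Γ₁ ↭ Γ′ ++ map (atomᵢ p ts) Ss → Partition (R₁ ∷ Ss) →
          ⊢[ n ]⟨ k × [ R₁ ] atom p ts ⟩ Γ₁ → Principal n k R₁ (atom p ts) Γ₁
    ¬-ruleₚ : ∀ {m k R₁ f B Γ₁} → ⊢[ m ]⟨ k × [ R₁ ] neg f B ⟩ [ pre f R₁ ] B ∷ Γ₁ →
              ⊢[ suc m ]⟨ suc k × [ R₁ ] neg f B ⟩ Γ₁ → Principal (suc m) (suc k) R₁ (neg f B) Γ₁
    ∧-neg₁ₚ : ∀ {m k R₁ 𝒰 B C Γ₁} → R₁ ∉ 𝒰 → ⊢[ m ]⟨ k × [ R₁ ] conj 𝒰 B C ⟩ [ R₁ ] B ∷ Γ₁ →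
              ⊢[ suc m ]⟨ suc k × [ R₁ ] conj 𝒰 B C ⟩ Γ₁ → Principal (suc m) (suc k) R₁ (conj 𝒰 B C) Γ₁
    ∧-neg₂ₚ : ∀ {m k R₁ 𝒰 B C Γ₁} → R₁ ∉ 𝒰 → ⊢[ m ]⟨ k × [ R₁ ] conj 𝒰 B C ⟩ [ R₁ ] C ∷ Γ₁ →
              ⊢[ suc m ]⟨ suc k × [ R₁ ] conj 𝒰 B C ⟩ Γ₁ → Principal (suc m) (suc k) R₁ (conj 𝒰 B C) Γ₁
    ∧-posₚ : ∀ {m k R₁ 𝒰 B C Γ₁} → R₁ ∈ 𝒰 → ⊢[ m ]⟨ k × [ R₁ ] conj 𝒰 B C ⟩ [ R₁ ] B ∷ Γ₁ →
             ⊢[ m ]⟨ k × [ R₁ ] conj 𝒰 B C ⟩ [ R₁ ] C ∷ Γ₁ →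
             ⊢[ suc m ]⟨ suc k × [ R₁ ] conj 𝒰 B C ⟩ Γ₁ → Principal (suc m) (suc k) R₁ (conj 𝒰 B C) Γ₁
    ⊃-negₚ : ∀ {m k R₁ f 𝒰 B C Γ₁} → R₁ ∉ 𝒰 →
             ⊢[ m ]⟨ k × [ R₁ ] imp f 𝒰 B C ⟩ [ R₁ ] C ∷ [ pre f R₁ ] B ∷ Γ₁ →
             ⊢[ suc m ]⟨ suc k × [ R₁ ] imp f 𝒰 B C ⟩ Γ₁ → Principal (suc m) (suc k) R₁ (imp f 𝒰 B C) Γ₁
    ⊃-posₚ : ∀ {m k ka kb R₁ f 𝒰 B C Γ₁ Γa Γb} → R₁ ∈ 𝒰 →
             ⊢[ m ]⟨ ka × [ R₁ ] imp f 𝒰 B C ⟩ [ pre f R₁ ] B ∷ Γa →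
             ⊢[ m ]⟨ kb × [ R₁ ] imp f 𝒰 B C ⟩ [ R₁ ] C ∷ Γb → Γ₁ ↭ Γa ++ Γb →
             ⊢[ suc m ]⟨ suc k × [ R₁ ] imp f 𝒰 B C ⟩ Γ₁ → Principal (suc m) (suc k) R₁ (imp f 𝒰 B C) Γ₁
    ∀-negₚ : ∀ {m k R₁ 𝒰 B Γ₁} (t : Term) → R₁ ∉ 𝒰 → ⊢[ m ]⟨ k × [ R₁ ] all 𝒰 B ⟩ [ R₁ ] (B [0:= t ]) ∷ Γ₁ →
             ⊢[ suc m ]⟨ suc k × [ R₁ ] all 𝒰 B ⟩ Γ₁ → Principal (suc m) (suc k) R₁ (all 𝒰 B) Γ₁
    ∀-posₚ : ∀ {m k R₁ 𝒰 B Γ₁} → R₁ ∈ 𝒰 → ⊢[ m ]⟨ k × [ R₁ ] renF suc (all 𝒰 B) ⟩ [ R₁ ] B ∷ shiftS Γ₁ →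
             ⊢[ suc m ]⟨ suc k × [ R₁ ] all 𝒰 B ⟩ Γ₁ → Principal (suc m) (suc k) R₁ (all 𝒰 B) Γ₁

  Principal⇒⊢[]⟨⟩ : ∀ {n k R₁ A Γ₁} → Principal n k R₁ A Γ₁ → ⊢[ n ]⟨ k × [ R₁ ] A ⟩ Γ₁
  Principal⇒⊢[]⟨⟩ (Idₚ _ _ _ _ d)      = d
  Principal⇒⊢[]⟨⟩ (¬-ruleₚ _ d)        = d
  Principal⇒⊢[]⟨⟩ (∧-neg₁ₚ _ _ d)      = d
  Principal⇒⊢[]⟨⟩ (∧-neg₂ₚ _ _ d)      = d
  Principal⇒⊢[]⟨⟩ (∧-posₚ _ _ _ d)     = d
  Principal⇒⊢[]⟨⟩ (⊃-negₚ _ _ d)       = d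
  Principal⇒⊢[]⟨⟩ (⊃-posₚ _ _ _ _ d)   = d
  Principal⇒⊢[]⟨⟩ (∀-negₚ _ _ _ d)     = d
  Principal⇒⊢[]⟨⟩ (∀-posₚ _ _ d)       = d

  last-rule : ∀ {n k R₁ A Γ₁} → ⊢[ n ]⟨ k × [ R₁ ] A ⟩ Γ₁ → Principal n k R₁ A Γ₁ ⊎ NonPrincipal n k R₁ A Γ₁
  last-rule {k = k} {R₁} {A} {Γ₁} d@(copies (Idʰ Γ p ts Rs l part π)) with Id-view k R₁ A Γ₁ Γ p ts Rs π part l
  ... | inj₁ (Γ′ , Ss , q , part′ , l′)   = inj₂ (Idₙ Γ′ p ts Ss q part′ l′)
  ... | inj₂ (refl , Γ′ , Ss , q , part′) = inj₁ (Idₚ Γ′ Ss q part′ d)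
  last-rule {k = k} {R₁} {A} {Γ₁} (copies (contractionʰ dd π)) with ↭-copies-∷ k ([ R₁ ] A) Γ₁ π
  ... | inj₁ (k′ , refl , e , q) = inj₂ (copy-contractionₙ (copies (⊢[]-resp-↭ (prep e (prep e q)) dd)))
  ... | inj₂ (Γ₁′ , p , q)       = inj₂ (contractionₙ (⊢[]⟨⟩-∷∷ ≈ᵢ-refl ≈ᵢ-refl q dd) p)
  last-rule {k = k} {R₁} {A} {Γ₁} d@(copies (¬-ruleʰ {f = f} dd π)) with ↭-copies-∷ k ([ R₁ ] A) Γ₁ π
  ... | inj₁ (k′ , refl , (e , refl) , q) = inj₁ (¬-ruleₚ (⊢[]⟨⟩-∷ ((λ r → e (f r)) , refl) q dd) d)
  ... | inj₂ (Γ₁′ , p , q)                = inj₂ (¬-ruleₙ (⊢[]⟨⟩-∷ ≈ᵢ-refl q dd) p)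
  last-rule {k = k} {R₁} {A} {Γ₁} d@(copies (∧-neg₁ʰ {𝒰 = 𝒰} u dd π)) with ↭-copies-∷ k ([ R₁ ] A) Γ₁ π
  ... | inj₁ (k′ , refl , (e , refl) , q) = inj₁ (∧-neg₁ₚ (∉-resp-≐ 𝒰 e u) (⊢[]⟨⟩-∷ (e , refl) q dd) d)
  ... | inj₂ (Γ₁′ , p , q)                = inj₂ (∧-neg₁ₙ u (⊢[]⟨⟩-∷ ≈ᵢ-refl q dd) p)
  last-rule {k = k} {R₁} {A} {Γ₁} d@(copies (∧-neg₂ʰ {𝒰 = 𝒰} u dd π)) with ↭-copies-∷ k ([ R₁ ] A) Γ₁ π
  ... | inj₁ (k′ , refl , (e , refl) , q) = inj₁ (∧-neg₂ₚ (∉-resp-≐ 𝒰 e u) (⊢[]⟨⟩-∷ (e , refl) q dd) d)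
  ... | inj₂ (Γ₁′ , p , q)                = inj₂ (∧-neg₂ₙ u (⊢[]⟨⟩-∷ ≈ᵢ-refl q dd) p)
  last-rule {k = k} {R₁} {A} {Γ₁} d@(copies (∧-posʰ {𝒰 = 𝒰} u dd dd′ π)) with ↭-copies-∷ k ([ R₁ ] A) Γ₁ π
  ... | inj₁ (k′ , refl , (e , refl) , q) =
    inj₁ (∧-posₚ (∈-resp-≐ 𝒰 e u) (⊢[]⟨⟩-∷ (e , refl) q dd) (⊢[]⟨⟩-∷ (e , refl) q dd′) d)
  ... | inj₂ (Γ₁′ , p , q) = inj₂ (∧-posₙ u (⊢[]⟨⟩-∷ ≈ᵢ-refl q dd) (⊢[]⟨⟩-∷ ≈ᵢ-refl q dd′) p)
  last-rule {k = k} {R₁} {A} {Γ₁} d@(copies (⊃-negʰ {f = f} {𝒰} u dd π)) with ↭-copies-∷ k ([ R₁ ] A) Γ₁ π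
  ... | inj₁ (k′ , refl , (e , refl) , q) =
    inj₁ (⊃-negₚ (∉-resp-≐ 𝒰 e u) (⊢[]⟨⟩-∷∷ (e , refl) ((λ r → e (f r)) , refl) q dd) d)
  ... | inj₂ (Γ₁′ , p , q) = inj₂ (⊃-negₙ u (⊢[]⟨⟩-∷∷ ≈ᵢ-refl ≈ᵢ-refl q dd) p)
  last-rule {k = k} {R₁} {A} {Γ₁} d@(copies (⊃-posʰ {Γ₁ = Γa} {Γb} {f = f} {𝒰} u da db π))
    with ↭-copies-∷ k ([ R₁ ] A) Γ₁ π
  ... | inj₁ (k′ , refl , (e , refl) , q) with ↭-copies-++ k′ ([ R₁ ] A) Γ₁ Γa Γb q
  ... | ka , kb , Γa′ , Γb′ , pa , pb , r =
    inj₁ (⊃-posₚ (∈-resp-≐ 𝒰 e u) (⊢[]⟨⟩-∷ {k = ka} {Γ₁ = Γa′} ((λ r → e (f r)) , refl) pa da)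
                                    (⊢[]⟨⟩-∷ {k = kb} {Γ₁ = Γb′} (e , refl) pb db) r d)
  last-rule {k = k} {R₁} {A} {Γ₁} (copies (⊃-posʰ {Γ₁ = Γa} {Γb} u da db π)) | inj₂ (Γ₁′ , p , q)
    with ↭-copies-++ k ([ R₁ ] A) Γ₁′ Γa Γb q
  ... | ka , kb , Γa′ , Γb′ , pa , pb , r =
    inj₂ (⊃-posₙ u (⊢[]⟨⟩-∷ {k = ka} {Γ₁ = Γa′} ≈ᵢ-refl pa da) (⊢[]⟨⟩-∷ {k = kb} {Γ₁ = Γb′} ≈ᵢ-refl pb db)
                   (↭-trans p (↭-prep _ r)))
  last-rule {k = k} {R₁} {A} {Γ₁} d@(copies (∀-negʰ {𝒰 = 𝒰} t u dd π)) with ↭-copies-∷ k ([ R₁ ] A) Γ₁ π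
  ... | inj₁ (k′ , refl , (e , refl) , q) = inj₁ (∀-negₚ t (∉-resp-≐ 𝒰 e u) (⊢[]⟨⟩-∷ (e , refl) q dd) d)
  ... | inj₂ (Γ₁′ , p , q)                = inj₂ (∀-negₙ t u (⊢[]⟨⟩-∷ ≈ᵢ-refl q dd) p)
  last-rule {k = k} {R₁} {A} {Γ₁} d@(copies (∀-posʰ {𝒰 = 𝒰} u dd π)) with ↭-copies-∷ k ([ R₁ ] A) Γ₁ π
  ... | inj₁ (k′ , refl , (e , refl) , q) =
    inj₁ (∀-posₚ (∈-resp-≐ 𝒰 e u) (⊢[]⟨⟩-∷ (e , refl) (shiftS-↭-replicate-++ k′ q) dd) d)
  ... | inj₂ (Γ₁′ , p , q) = inj₂ (∀-posₙ u (⊢[]⟨⟩-∷ ≈ᵢ-refl (shiftS-↭-replicate-++ k q) dd) p)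

  exchange : ∀ {x y Γ} → ⊢′ x ∷ y ∷ Γ → ⊢′ y ∷ x ∷ Γ
  exchange {x} {y} d = d ⟫ ↭-swap x y ↭-refl

  exchange₂ : ∀ {x y z Γ} → ⊢′ x ∷ y ∷ z ∷ Γ → ⊢′ y ∷ z ∷ x ∷ Γ
  exchange₂ {x} {y} {z} d = d ⟫ ↭-trans (↭-swap x y ↭-refl) (↭-prep y (↭-swap x z ↭-refl))

  pull : ∀ {x y} Γ {Δ} → ⊢′ x ∷ Γ ++ y ∷ Δ → ⊢′ y ∷ x ∷ Γ ++ Δ
  pull {x} {y} Γ {Δ} d = d ⟫ ↭-trans (↭-prep x (↭-shift Γ Δ)) (↭-swap x y ↭-refl)

  pull₂ : ∀ {x y z} Γ {Δ} → ⊢′ x ∷ Γ ++ y ∷ z ∷ Δ → ⊢′ y ∷ z ∷ x ∷ Γ ++ Δ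
  pull₂ {x} {y} {z} Γ {Δ} d =
    d ⟫ solve 5 (λ X Y Z G D → X ⊕ (G ⊕ (Y ⊕ (Z ⊕ D))) ⊜ Y ⊕ (Z ⊕ (X ⊕ (G ⊕ D)))) ↭-refl
                (x ∷ []) (y ∷ []) (z ∷ []) Γ Δ

  push : ∀ {x y Γ Γ′} Δ → Γ ↭ y ∷ Γ′ → ⊢′ y ∷ x ∷ Γ′ ++ Δ → ⊢′ x ∷ Γ ++ Δ
  push {x} {y} Δ p d = d ⟫ ↭-trans (↭-swap y x ↭-refl) (↭-prep x (++⁺ʳ Δ (↭-sym p)))

  -- repeat b Γ consists of b + 1 copies of Γ.
  repeat : ℕ → Sequent → Sequent
  repeat zero    Γ = Γ
  repeat (suc b) Γ = Γ ++ repeat b Γ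

  contract-repeat : ∀ b Γ Δ → ⊢′ repeat b Γ ++ Δ → ⊢′ Γ ++ Δ
  contract-repeat zero    Γ Δ d = d
  contract-repeat (suc b) Γ Δ d =
    contract-++ Γ (contract-repeat b Γ (Γ ++ Δ)
                     (d ⟫ solve 3 (λ G R D → (G ⊕ R) ⊕ D ⊜ R ⊕ (G ⊕ D)) ↭-refl Γ (repeat b Γ) Δ))

  contract-replicate : ∀ j x Γ → ⊢′ replicate (suc j) x ++ Γ → ⊢′ x ∷ Γ
  contract-replicate zero    x Γ d = d
  contract-replicate (suc j) x Γ d = contract-replicate j x Γ (contraction′ d)

  contract-spill : ∀ a b c {S} Γ₁ {Γ₂} → ⊢′ replicate (suc a) S ++ (repeat b Γ₁ ++ repeat c Γ₂) →
                   ⊢′ S ∷ Γ₁ ++ Γ₂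
  contract-spill a b c {S} Γ₁ {Γ₂} d =
    contract-replicate a S (Γ₁ ++ Γ₂)
      (contract-repeat b Γ₁ (Ss ++ Γ₂)
         (contract-repeat c Γ₂ (Ss ++ repeat b Γ₁)
            (d ⟫ solve 3 (λ X Y Z → X ⊕ (Y ⊕ Z) ⊜ Z ⊕ (X ⊕ Y)) ↭-refl Ss (repeat b Γ₁) (repeat c Γ₂))
          ⟫ solve 3 (λ X Y Z → Z ⊕ (X ⊕ Y) ⊜ Y ⊕ (X ⊕ Z)) ↭-refl Ss (repeat b Γ₁) Γ₂)
       ⟫ solve 3 (λ X Y Z → Y ⊕ (X ⊕ Z) ⊜ X ⊕ (Y ⊕ Z)) ↭-refl Ss Γ₁ Γ₂)
    where Ss = replicate (suc a) S

  contract-spill₁ : ∀ {S} Γ₁ {Γ₂} → ⊢′ S ∷ (S ∷ Γ₁ ++ Γ₂) ++ (S ∷ Γ₁ ++ Γ₂) → ⊢′ S ∷ Γ₁ ++ Γ₂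
  contract-spill₁ {S} Γ₁ {Γ₂} d =
    contract-spill 2 1 1 Γ₁
      (d ⟫ solve 3 (λ X G₁ G₂ → X ⊕ ((X ⊕ (G₁ ⊕ G₂)) ⊕ (X ⊕ (G₁ ⊕ G₂))) ⊜
                                (X ⊕ (X ⊕ X)) ⊕ ((G₁ ⊕ G₁) ⊕ (G₂ ⊕ G₂))) ↭-refl (S ∷ []) Γ₁ Γ₂)

  ⊢[]⟨⟩-shift : ∀ {n k x Γ} → ⊢[ n ]⟨ k × x ⟩ Γ → ⊢[ n ]⟨ k × shiftI x ⟩ shiftS Γ
  ⊢[]⟨⟩-shift {k = k} {x} {Γ} (copies d) = copies (subst (⊢[ _ ]_) (shiftS-replicate-++ k x Γ) (⊢[]-shift d))

  suc-+-≤ : ∀ m₁ m₂ {N} → m₁ + suc m₂ ≤ N → suc m₁ + m₂ ≤ N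
  suc-+-≤ m₁ m₂ {N} = subst (_≤ N) (+-suc m₁ m₂)

  shiftS-spill : ∀ S Γ₁ Γ₂ → shiftS ((S ∷ Γ₁ ++ Γ₂) ++ (S ∷ Γ₁ ++ Γ₂)) ≡
                 (shiftI S ∷ shiftS Γ₁ ++ shiftS Γ₂) ++ (shiftI S ∷ shiftS Γ₁ ++ shiftS Γ₂)
  shiftS-spill S Γ₁ Γ₂ = trans (map-++ shiftI (S ∷ Γ₁ ++ Γ₂) (S ∷ Γ₁ ++ Γ₂)) (cong₂ _++_ e e)
    where e = cong (shiftI S ∷_) (map-++ shiftI Γ₁ Γ₂)

  mutual
    cut : ∀ K {B R R′ Γ Δ} → size B ≤ K → Covers R R′ →
          ⊢′ [ R ] B ∷ Γ → ⊢′ [ R′ ] B ∷ Δ → ⊢′ [ R ∩ R′ ] B ∷ Γ ++ Δ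
    cut K sz c (n , d) (n′ , d′) = mix K (n + n′) sz ≤-refl c (copies {k = 1} d) (copies {k = 1} d′)

    mix : ∀ K N {A R₁ R₂ Γ₁ Γ₂ n₁ n₂ k₁ k₂} → size A ≤ K → n₁ + n₂ ≤ N → Covers R₁ R₂ →
          ⊢[ n₁ ]⟨ k₁ × [ R₁ ] A ⟩ Γ₁ → ⊢[ n₂ ]⟨ k₂ × [ R₂ ] A ⟩ Γ₂ → ⊢′ [ R₁ ∩ R₂ ] A ∷ Γ₁ ++ Γ₂
    mix K N {R₁ = R₁} {R₂} {Γ₁} {Γ₂} {n₁} {n₂} sz h c d₁ d₂ with last-rule d₁
    ... | inj₂ v = mix-nonprincipalˡ K N sz h c v d₂
    ... | inj₁ p = mix-principalʳ K N sz (subst (_≤ N) (+-comm n₁ n₂) h) (Covers-sym {R₁} {R₂} c) d₂ p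
                   ⟫ ↭-trans (prep (∩-comm R₂ R₁ , refl) ↭-refl) (↭-prep _ (++-comm Γ₂ Γ₁))

    mix-principalʳ : ∀ K N {A R₁ R₂ Γ₁ Γ₂ n₁ n₂ k₁ k₂} → size A ≤ K → n₁ + n₂ ≤ N → Covers R₁ R₂ →
                     ⊢[ n₁ ]⟨ k₁ × [ R₁ ] A ⟩ Γ₁ → Principal n₂ k₂ R₂ A Γ₂ → ⊢′ [ R₁ ∩ R₂ ] A ∷ Γ₁ ++ Γ₂
    mix-principalʳ K N sz h c d₁ p with last-rule d₁
    ... | inj₂ v = mix-nonprincipalˡ K N sz h c v (Principal⇒⊢[]⟨⟩ p)
    ... | inj₁ q = mix-principal K N sz h c q p

    mix-nonprincipalˡ : ∀ K N {A R₁ R₂ Γ₁ Γ₂ n₁ n₂ k₁ k₂} → size A ≤ K → n₁ + n₂ ≤ N → Covers R₁ R₂ →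
                        NonPrincipal n₁ k₁ R₁ A Γ₁ → ⊢[ n₂ ]⟨ k₂ × [ R₂ ] A ⟩ Γ₂ → ⊢′ [ R₁ ∩ R₂ ] A ∷ Γ₁ ++ Γ₂
    mix-nonprincipalˡ K N {A} {R₁} {R₂} {Γ₁} {Γ₂} sz h c (Idₙ Γ′ p ts Ss q part l) d₂ =
      0 , Idʰ ([ R₁ ∩ R₂ ] A ∷ Γ′ ++ Γ₂) p ts Ss l part
            (↭-trans (↭-prep _ (++⁺ʳ Γ₂ q))
                     (solve 4 (λ X G M D → X ⊕ ((G ⊕ M) ⊕ D) ⊜ (X ⊕ (G ⊕ D)) ⊕ M) ↭-refl
                              ([ R₁ ∩ R₂ ] A ∷ []) Γ′ (map (atomᵢ p ts) Ss) Γ₂))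
    mix-nonprincipalˡ K (suc N) sz (s≤s h) c (copy-contractionₙ d) d₂ = mix K N sz h c d d₂
    mix-nonprincipalˡ K (suc N) {Γ₂ = Γ₂} sz (s≤s h) c (contractionₙ d p) d₂ =
      push Γ₂ p (contraction′ (exchange₂ (mix K N sz h c d d₂)))
    mix-nonprincipalˡ K (suc N) {Γ₂ = Γ₂} sz (s≤s h) c (¬-ruleₙ d p) d₂ =
      push Γ₂ p (¬-rule′ (exchange (mix K N sz h c d d₂)))
    mix-nonprincipalˡ K (suc N) {Γ₂ = Γ₂} sz (s≤s h) c (∧-neg₁ₙ u d p) d₂ =
      push Γ₂ p (∧-neg₁′ u (exchange (mix K N sz h c d d₂)))
    mix-nonprincipalˡ K (suc N) {Γ₂ = Γ₂} sz (s≤s h) c (∧-neg₂ₙ u d p) d₂ =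
      push Γ₂ p (∧-neg₂′ u (exchange (mix K N sz h c d d₂)))
    mix-nonprincipalˡ K (suc N) {Γ₂ = Γ₂} sz (s≤s h) c (∧-posₙ u d d′ p) d₂ =
      push Γ₂ p (∧-pos′ u (exchange (mix K N sz h c d d₂)) (exchange (mix K N sz h c d′ d₂)))
    mix-nonprincipalˡ K (suc N) {Γ₂ = Γ₂} sz (s≤s h) c (⊃-negₙ u d p) d₂ =
      push Γ₂ p (⊃-neg′ u (exchange₂ (mix K N sz h c d d₂)))
    mix-nonprincipalˡ K (suc N) {A} {R₁} {R₂} {Γ₂ = Γ₂} sz (s≤s h) c
                      (⊃-posₙ {Γa = Γa} {Γb} {R} {f} {𝒰} {B} {C} u da db p) d₂ =
      push Γ₂ p (contract-++ (S ∷ Γ₂)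
        (⊃-pos′ u (exchange (mix K N sz h c da d₂)) (exchange (mix K N sz h c db d₂))
          ⟫ solve 5 (λ Y X Ga Gb G₂ → Y ⊕ ((X ⊕ (Ga ⊕ G₂)) ⊕ (X ⊕ (Gb ⊕ G₂))) ⊜
                                      (X ⊕ G₂) ⊕ ((X ⊕ G₂) ⊕ (Y ⊕ (Ga ⊕ Gb)))) ↭-refl
                    ([ R ] imp f 𝒰 B C ∷ []) (S ∷ []) Γa Γb Γ₂)
        ⟫ solve 5 (λ Y X Ga Gb G₂ → (X ⊕ G₂) ⊕ (Y ⊕ (Ga ⊕ Gb)) ⊜ Y ⊕ (X ⊕ ((Ga ⊕ Gb) ⊕ G₂))) ↭-refl
                  ([ R ] imp f 𝒰 B C ∷ []) (S ∷ []) Γa Γb Γ₂)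
      where S = [ R₁ ∩ R₂ ] A
    mix-nonprincipalˡ K (suc N) {Γ₂ = Γ₂} sz (s≤s h) c (∀-negₙ t u d p) d₂ =
      push Γ₂ p (∀-neg′ t u (exchange (mix K N sz h c d d₂)))
    mix-nonprincipalˡ K (suc N) {A} {R₁} {R₂} {Γ₂ = Γ₂} sz (s≤s h) c
                      (∀-posₙ {Γ₁′ = Γ₁′} {R} {B = B} u d p) d₂ =
      push Γ₂ p (∀-pos′ u (exchange (mix K N (subst (_≤ K) (sym (size-renF-suc A)) sz) h c d (⊢[]⟨⟩-shift d₂))
                            ⟫ ↭-reflexive (cong (λ Θ → [ R ] B ∷ shiftI ([ R₁ ∩ R₂ ] A) ∷ Θ)
                                                (sym (map-++ shiftI Γ₁′ Γ₂)))))

    mix-principal : ∀ K N {A R₁ R₂ Γ₁ Γ₂ n₁ n₂ k₁ k₂} → size A ≤ K → n₁ + n₂ ≤ N → Covers R₁ R₂ →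
                    Principal n₁ k₁ R₁ A Γ₁ → Principal n₂ k₂ R₂ A Γ₂ → ⊢′ [ R₁ ∩ R₂ ] A ∷ Γ₁ ++ Γ₂
    mix-principal K N {atom p ts} _ _ = mix-principal-atom
    mix-principal K N {neg f B}   = mix-principal-¬ K N
    mix-principal K N {conj 𝒰 B C}  = mix-principal-∧ K N
    mix-principal K N {imp f 𝒰 B C} = mix-principal-⊃ K N
    mix-principal K N {all 𝒰 B}   = mix-principal-∀ K N

    mix-principal-atom : ∀ {p ts R₁ R₂ Γ₁ Γ₂ n₁ n₂ k₁ k₂} → Covers R₁ R₂ →
      Principal n₁ k₁ R₁ (atom p ts) Γ₁ → Principal n₂ k₂ R₂ (atom p ts) Γ₂ → ⊢′ [ R₁ ∩ R₂ ] atom p ts ∷ Γ₁ ++ Γ₂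
    mix-principal-atom {p} {ts} {R₁} {R₂} c (Idₚ Γ′ Ss q part _) (Idₚ Γ″ Ts q′ part′ _) =
      0 , Idʰ (Γ′ ++ Γ″) p ts ((R₁ ∩ R₂) ∷ Ss ++ Ts) (s≤s z≤n) (Partition-∩ R₁ R₂ Ss Ts part part′ c)
            (↭-trans (↭-prep _ (++⁺ q q′))
            (↭-trans (solve 5 (λ X G₁ M₁ G₂ M₂ → X ⊕ ((G₁ ⊕ M₁) ⊕ (G₂ ⊕ M₂)) ⊜ (G₁ ⊕ G₂) ⊕ (X ⊕ (M₁ ⊕ M₂)))
                              ↭-refl (at (R₁ ∩ R₂) ∷ []) Γ′ (map at Ss) Γ″ (map at Ts))
                     (↭-reflexive (cong (λ Θ → (Γ′ ++ Γ″) ++ at (R₁ ∩ R₂) ∷ Θ) (sym (map-++ at Ss Ts))))))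
      where at = atomᵢ p ts

    mix-principal-¬ : ∀ K N {f B R₁ R₂ Γ₁ Γ₂ n₁ n₂ k₁ k₂} → size (neg f B) ≤ K → n₁ + n₂ ≤ N → Covers R₁ R₂ →
      Principal n₁ k₁ R₁ (neg f B) Γ₁ → Principal n₂ k₂ R₂ (neg f B) Γ₂ → ⊢′ [ R₁ ∩ R₂ ] neg f B ∷ Γ₁ ++ Γ₂
    mix-principal-¬ (suc K) (suc N) {f} {R₁ = R₁} {R₂} {Γ₁} sz@(s≤s szB) (s≤s h) c
                    (¬-ruleₚ {m = m₁} dl d₁) (¬-ruleₚ {m = m₂} dr d₂) =
      contract-spill₁ Γ₁ (¬-rule′ (cut K szB (Covers-pre {R₁} {R₂} f c)
        (exchange (mix (suc K) N sz h c dl d₂))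
        (pull Γ₁ (mix (suc K) N sz (suc-+-≤ m₁ m₂ h) c d₁ dr))))

    mix-principal-∧ : ∀ K N {𝒰 B C R₁ R₂ Γ₁ Γ₂ n₁ n₂ k₁ k₂} → size (conj 𝒰 B C) ≤ K → n₁ + n₂ ≤ N →
      Covers R₁ R₂ → Principal n₁ k₁ R₁ (conj 𝒰 B C) Γ₁ → Principal n₂ k₂ R₂ (conj 𝒰 B C) Γ₂ →
      ⊢′ [ R₁ ∩ R₂ ] conj 𝒰 B C ∷ Γ₁ ++ Γ₂
    mix-principal-∧ (suc K) (suc N) {𝒰} {B} {Γ₁ = Γ₁} sz@(s≤s szBC) (s≤s h) c
                    (∧-posₚ {m = m₁} u dB dC d₁) (∧-posₚ {m = m₂} u′ dB′ dC′ d₂) =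
      contract-spill₁ Γ₁ (∧-pos′ (∩-closed 𝒰 u u′)
        (cut K (m+n≤o⇒m≤o (size B) szBC) c (exchange (mix (suc K) N sz h c dB d₂))
                                            (pull Γ₁ (mix (suc K) N sz (suc-+-≤ m₁ m₂ h) c d₁ dB′)))
        (cut K (m+n≤o⇒n≤o (size B) szBC) c (exchange (mix (suc K) N sz h c dC d₂))
                                            (pull Γ₁ (mix (suc K) N sz (suc-+-≤ m₁ m₂ h) c d₁ dC′))))
    mix-principal-∧ (suc K) (suc N) {𝒰} {B} {Γ₁ = Γ₁} sz@(s≤s szBC) (s≤s h) c
                    (∧-posₚ {m = m₁} u dB dC d₁) (∧-neg₁ₚ {m = m₂} u′ dB′ d₂) =
      contract-spill₁ Γ₁ (∧-neg₁′ (∩-∉ʳ 𝒰 u′)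
        (cut K (m+n≤o⇒m≤o (size B) szBC) c (exchange (mix (suc K) N sz h c dB d₂))
                                            (pull Γ₁ (mix (suc K) N sz (suc-+-≤ m₁ m₂ h) c d₁ dB′))))
    mix-principal-∧ (suc K) (suc N) {𝒰} {B} {Γ₁ = Γ₁} sz@(s≤s szBC) (s≤s h) c
                    (∧-posₚ {m = m₁} u dB dC d₁) (∧-neg₂ₚ {m = m₂} u′ dC′ d₂) =
      contract-spill₁ Γ₁ (∧-neg₂′ (∩-∉ʳ 𝒰 u′)
        (cut K (m+n≤o⇒n≤o (size B) szBC) c (exchange (mix (suc K) N sz h c dC d₂))
                                            (pull Γ₁ (mix (suc K) N sz (suc-+-≤ m₁ m₂ h) c d₁ dC′))))
    mix-principal-∧ (suc K) (suc N) {𝒰} {B} {Γ₁ = Γ₁} sz@(s≤s szBC) (s≤s h) c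
                    (∧-neg₁ₚ {m = m₁} u dB d₁) (∧-posₚ {m = m₂} u′ dB′ dC′ d₂) =
      contract-spill₁ Γ₁ (∧-neg₁′ (∩-∉ˡ 𝒰 u)
        (cut K (m+n≤o⇒m≤o (size B) szBC) c (exchange (mix (suc K) N sz h c dB d₂))
                                            (pull Γ₁ (mix (suc K) N sz (suc-+-≤ m₁ m₂ h) c d₁ dB′))))
    mix-principal-∧ (suc K) (suc N) {𝒰} {B} {Γ₁ = Γ₁} sz@(s≤s szBC) (s≤s h) c
                    (∧-neg₂ₚ {m = m₁} u dC d₁) (∧-posₚ {m = m₂} u′ dB′ dC′ d₂) =
      contract-spill₁ Γ₁ (∧-neg₂′ (∩-∉ˡ 𝒰 u)
        (cut K (m+n≤o⇒n≤o (size B) szBC) c (exchange (mix (suc K) N sz h c dC d₂))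
                                            (pull Γ₁ (mix (suc K) N sz (suc-+-≤ m₁ m₂ h) c d₁ dC′))))
    mix-principal-∧ _ _ {𝒰} _ _ c (∧-neg₁ₚ u _ _) (∧-neg₁ₚ u′ _ _) = ⊥-elim (Covers⇒¬both∉ 𝒰 c u u′)
    mix-principal-∧ _ _ {𝒰} _ _ c (∧-neg₁ₚ u _ _) (∧-neg₂ₚ u′ _ _) = ⊥-elim (Covers⇒¬both∉ 𝒰 c u u′)
    mix-principal-∧ _ _ {𝒰} _ _ c (∧-neg₂ₚ u _ _) (∧-neg₁ₚ u′ _ _) = ⊥-elim (Covers⇒¬both∉ 𝒰 c u u′)
    mix-principal-∧ _ _ {𝒰} _ _ c (∧-neg₂ₚ u _ _) (∧-neg₂ₚ u′ _ _) = ⊥-elim (Covers⇒¬both∉ 𝒰 c u u′)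

    mix-principal-⊃ : ∀ K N {f 𝒰 B C R₁ R₂ Γ₁ Γ₂ n₁ n₂ k₁ k₂} → size (imp f 𝒰 B C) ≤ K → n₁ + n₂ ≤ N →
      Covers R₁ R₂ → Principal n₁ k₁ R₁ (imp f 𝒰 B C) Γ₁ → Principal n₂ k₂ R₂ (imp f 𝒰 B C) Γ₂ →
      ⊢′ [ R₁ ∩ R₂ ] imp f 𝒰 B C ∷ Γ₁ ++ Γ₂
    mix-principal-⊃ (suc K) (suc N) {f} {𝒰} {B} {C} {R₁} {R₂} {Γ₁} {Γ₂} sz@(s≤s szBC) (s≤s h) c
                    (⊃-posₚ {m = m₁} {Γa = Γa} {Γb} u da db q d₁) (⊃-posₚ {m = m₂} {Γa = Γc} {Γd} u′ dc dd q′ d₂) =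
      contract-spill 4 2 2 Γ₁
        (⊃-pos′ (∩-closed 𝒰 u u′)
           (cut K (m+n≤o⇒m≤o (size B) szBC) (Covers-pre {R₁} {R₂} f c) (exchange (mix (suc K) N sz h c da d₂))
                                                             (pull Γ₁ (mix (suc K) N sz (suc-+-≤ m₁ m₂ h) c d₁ dc)))
           (cut K (m+n≤o⇒n≤o (size B) szBC) c (exchange (mix (suc K) N sz h c db d₂))
                                               (pull Γ₁ (mix (suc K) N sz (suc-+-≤ m₁ m₂ h) c d₁ dd)))
         ⟫ ↭-trans (solve 7 (λ X a b c d G₁ G₂ →
                               X ⊕ (((X ⊕ (a ⊕ G₂)) ⊕ (X ⊕ (G₁ ⊕ c))) ⊕ ((X ⊕ (b ⊕ G₂)) ⊕ (X ⊕ (G₁ ⊕ d)))) ⊜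
                               (X ⊕ (X ⊕ (X ⊕ (X ⊕ X)))) ⊕ ((G₁ ⊕ (G₁ ⊕ (a ⊕ b))) ⊕ (G₂ ⊕ (G₂ ⊕ (c ⊕ d)))))
                             ↭-refl (S ∷ []) Γa Γb Γc Γd Γ₁ Γ₂)
                   (++⁺ˡ (replicate 5 S) (++⁺ (++⁺ˡ Γ₁ (++⁺ˡ Γ₁ (↭-sym q))) (++⁺ˡ Γ₂ (++⁺ˡ Γ₂ (↭-sym q′))))))
      where S = [ R₁ ∩ R₂ ] imp f 𝒰 B C
    mix-principal-⊃ (suc K) (suc N) {f} {𝒰} {B} {C} {R₁} {R₂} {Γ₁} {Γ₂} sz@(s≤s szBC) (s≤s h) c
                    (⊃-posₚ {m = m₁} {Γa = Γa} {Γb} u da db q d₁) (⊃-negₚ {m = m₂} u′ dr d₂) =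
      contract-spill 3 1 2 Γ₁
        (⊃-neg′ (∩-∉ʳ 𝒰 u′)
           (cut K (m+n≤o⇒m≤o (size B) szBC) (Covers-pre {R₁} {R₂} f c) (exchange (mix (suc K) N sz h c da d₂))
              (cut K (m+n≤o⇒n≤o (size B) szBC) c (exchange (mix (suc K) N sz h c db d₂))
                                                  (pull₂ Γ₁ (mix (suc K) N sz (suc-+-≤ m₁ m₂ h) c d₁ dr))
               ⟫ ↭-trans (↭-prep _ (↭-shift (S ∷ Γb ++ Γ₂) (S ∷ Γ₁ ++ Γ₂))) (↭-swap _ _ ↭-refl))
            ⟫ ↭-trans (↭-prep _ (↭-shift (S ∷ Γa ++ Γ₂) ((S ∷ Γb ++ Γ₂) ++ (S ∷ Γ₁ ++ Γ₂)))) (↭-swap _ _ ↭-refl))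
         ⟫ ↭-trans (solve 5 (λ X a b G₁ G₂ →
                               X ⊕ ((X ⊕ (a ⊕ G₂)) ⊕ ((X ⊕ (b ⊕ G₂)) ⊕ (X ⊕ (G₁ ⊕ G₂)))) ⊜
                               (X ⊕ (X ⊕ (X ⊕ X))) ⊕ ((G₁ ⊕ (a ⊕ b)) ⊕ (G₂ ⊕ (G₂ ⊕ G₂))))
                             ↭-refl (S ∷ []) Γa Γb Γ₁ Γ₂)
                   (++⁺ˡ (replicate 4 S) (++⁺ʳ (Γ₂ ++ (Γ₂ ++ Γ₂)) (++⁺ˡ Γ₁ (↭-sym q)))))
      where S = [ R₁ ∩ R₂ ] imp f 𝒰 B C
    mix-principal-⊃ (suc K) (suc N) {f} {𝒰} {B} {C} {R₁} {R₂} {Γ₁} {Γ₂} sz@(s≤s szBC) (s≤s h) c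
                    (⊃-negₚ {m = m₁} u dl d₁) (⊃-posₚ {m = m₂} {Γa = Γc} {Γd} u′ dc dd q′ d₂) =
      contract-spill 3 2 1 Γ₁
        (⊃-neg′ (∩-∉ˡ 𝒰 u)
           (exchange (cut K (m+n≤o⇒m≤o (size B) szBC) (Covers-pre {R₁} {R₂} f c)
              (exchange (cut K (m+n≤o⇒n≤o (size B) szBC) c (exchange₂ (mix (suc K) N sz h c dl d₂))
                                                            (pull Γ₁ (mix (suc K) N sz (suc-+-≤ m₁ m₂ h) c d₁ dd))))
              (pull Γ₁ (mix (suc K) N sz (suc-+-≤ m₁ m₂ h) c d₁ dc))))
         ⟫ ↭-trans (solve 5 (λ X G₁ G₂ c d →
                               X ⊕ (((X ⊕ (G₁ ⊕ G₂)) ⊕ (X ⊕ (G₁ ⊕ d))) ⊕ (X ⊕ (G₁ ⊕ c))) ⊜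
                               (X ⊕ (X ⊕ (X ⊕ X))) ⊕ ((G₁ ⊕ (G₁ ⊕ G₁)) ⊕ (G₂ ⊕ (c ⊕ d))))
                             ↭-refl (S ∷ []) Γ₁ Γ₂ Γc Γd)
                   (++⁺ˡ (replicate 4 S) (++⁺ˡ (Γ₁ ++ (Γ₁ ++ Γ₁)) (++⁺ˡ Γ₂ (↭-sym q′)))))
      where S = [ R₁ ∩ R₂ ] imp f 𝒰 B C
    mix-principal-⊃ _ _ {𝒰 = 𝒰} _ _ c (⊃-negₚ u _ _) (⊃-negₚ u′ _ _) = ⊥-elim (Covers⇒¬both∉ 𝒰 c u u′)

    mix-principal-∀ : ∀ K N {𝒰 B R₁ R₂ Γ₁ Γ₂ n₁ n₂ k₁ k₂} → size (all 𝒰 B) ≤ K → n₁ + n₂ ≤ N → Covers R₁ R₂ →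
      Principal n₁ k₁ R₁ (all 𝒰 B) Γ₁ → Principal n₂ k₂ R₂ (all 𝒰 B) Γ₂ → ⊢′ [ R₁ ∩ R₂ ] all 𝒰 B ∷ Γ₁ ++ Γ₂
    mix-principal-∀ (suc K) (suc N) {𝒰} {B} {R₁} {R₂} {Γ₁} {Γ₂} sz@(s≤s szB) (s≤s h) c
                    (∀-posₚ {m = m₁} u dl d₁) (∀-negₚ {m = m₂} t u′ dr d₂) =
      contract-spill₁ Γ₁ (∀-neg′ t (∩-∉ʳ 𝒰 u′) (cut K (subst (_≤ K) (sym (size-subF (single t) B)) szB) c
        (exchange (⊢′-instantiate t ([ R₁ ∩ R₂ ] all 𝒰 B) ([ R₁ ] B) (Γ₁ ++ Γ₂)
           (mix (suc K) N (subst (_≤ suc K) (sym (size-renF-suc (all 𝒰 B))) sz) h c dl (⊢[]⟨⟩-shift d₂)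
            ⟫ ↭-reflexive (cong (λ Θ → shiftI ([ R₁ ∩ R₂ ] all 𝒰 B) ∷ [ R₁ ] B ∷ Θ) (sym (map-++ shiftI Γ₁ Γ₂))))))
        (pull Γ₁ (mix (suc K) N sz (suc-+-≤ m₁ m₂ h) c d₁ dr))))
    mix-principal-∀ (suc K) (suc N) {𝒰} {B} {R₁} {R₂} {Γ₁} {Γ₂} sz@(s≤s szB) (s≤s h) c
                    (∀-negₚ {m = m₁} t u dl d₁) (∀-posₚ {m = m₂} u′ dr d₂) =
      contract-spill₁ Γ₁ (∀-neg′ t (∩-∉ˡ 𝒰 u) (cut K (subst (_≤ K) (sym (size-subF (single t) B)) szB) c
        (exchange (mix (suc K) N sz h c dl d₂))
        (exchange (⊢′-instantiate t ([ R₁ ∩ R₂ ] all 𝒰 B) ([ R₂ ] B) (Γ₁ ++ Γ₂)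
           (exchange (pull (shiftS Γ₁)
                           (mix (suc K) N (subst (_≤ suc K) (sym (size-renF-suc (all 𝒰 B))) sz) (suc-+-≤ m₁ m₂ h) c
                                (⊢[]⟨⟩-shift d₁) dr))
            ⟫ ↭-reflexive (cong (λ Θ → shiftI ([ R₁ ∩ R₂ ] all 𝒰 B) ∷ [ R₂ ] B ∷ Θ) (sym (map-++ shiftI Γ₁ Γ₂))))))))
    mix-principal-∀ (suc K) (suc N) {𝒰} {B} {R₁} {R₂} {Γ₁} {Γ₂} sz@(s≤s szB) (s≤s h) c
                    (∀-posₚ {m = m₁} u dl d₁) (∀-posₚ {m = m₂} u′ dr d₂) =
      contract-spill₁ Γ₁ (∀-pos′ (∩-closed 𝒰 u u′) (cut K szB c
          (exchange (mix (suc K) N sz′ h c dl (⊢[]⟨⟩-shift d₂)))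
          (pull (shiftS Γ₁) (mix (suc K) N sz′ (suc-+-≤ m₁ m₂ h) c (⊢[]⟨⟩-shift d₁) dr))
        ⟫ ↭-reflexive (cong ([ R₁ ∩ R₂ ] B ∷_) (sym (shiftS-spill ([ R₁ ∩ R₂ ] all 𝒰 B) Γ₁ Γ₂)))))
      where sz′ = subst (_≤ suc K) (sym (size-renF-suc (all 𝒰 B))) sz
    mix-principal-∀ _ _ {𝒰} _ _ c (∀-negₚ _ u _ _) (∀-negₚ _ u′ _ _) = ⊥-elim (Covers⇒¬both∉ 𝒰 c u u′)

  cut-with-spill : ∀ R₁ R₂ → Covers R₁ R₂ → ∀ Γ₁ Γ₂ A →
                   ⊢ (Γ₁ ,, [ R₁ ] A) → ⊢ (Γ₂ ,, [ R₂ ] A) → ⊢ (Γ₁ ++ Γ₂ ,, [ R₁ ∩ R₂ ] A)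
  cut-with-spill R₁ R₂ covers Γ₁ Γ₂ A d₁ d₂ =
    perm (∷↭∷ʳ _ (Γ₁ ++ Γ₂))
         (⊢[]⇒⊢ (proj₂ (cut (size A) ≤-refl covers
                              (⊢⇒⊢′ d₁ ⟫ ↭-sym (∷↭∷ʳ _ Γ₁)) (⊢⇒⊢′ d₂ ⟫ ↭-sym (∷↭∷ʳ _ Γ₂)))))

lemma5 : (ℛ : Set) → let open MRL ℛ in
    ∀ (R₁ R₂ : Subset) → (∀ r → (∁ R₁ ∩ ∁ R₂) r ≡ false) →
    ∀ (Γ₁ Γ₂ : Sequent) (A : Formula) →
    ⊢ (Γ₁ ,, [ R₁ ] A) → ⊢ (Γ₂ ,, [ R₂ ] A) →
    ⊢ (Γ₁ ++ Γ₂ ,, [ R₁ ∩ R₂ ] A)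
lemma5 ℛ = CutAdmissibility.cut-with-spill ℛ
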